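{- Let $G=(V,E)$ be a finite simple graph, with one variable $x_{ij}=x_{ji}$ for each edge $\{i,j\}\in E$, and consider the system $\sum_{j\in N(i)}x_{ij}-1=0$ for $i\in V$, and $x_{ij}x_{ik}=0$ for all $i\in V$ and distinct $j,k\in N(i)$. If this system is infeasible, then there is a Nullstellensatz certificate, i.e. polynomials $\Delta_i$ ($i\in V$) and $\Theta^i_{jk}$ (for $i\in V$, distinct $j,k\in N(i)$) with $$1=\sum_{i\in V}\Delta_i\Big(\sum_{j\in N(i)}x_{ij}-1\Big)+\sum_{i,\,j\neq k}\Theta^i_{jk}x_{ij}x_{ik},$$ such that (a) the degree of each $\Delta_i$ equals the size of a maximum matching of $G$; (b) for every matching $M$ of $G$, the monomial $\prod_{\{i,j\}\in M}x_{ij}$ appears with non-zero coefficient in $\Delta_i$ for all $i\in V$; (c) $\deg\Theta^i_{jk}\le\deg\Delta_\ell$ for all indices $i,j,k,\ell$.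
   Context: $N(i)$ denotes the neighborhood of vertex $i$. The empty matching is included among matchings (its monomial is $1$). -}

module Defs where

open import Level using (Level; _⊔_) renaming (suc to lsuc)
open import Algebra.Bundles using (CommutativeRing)
open import Data.Bool using (Bool; true; false; if_then_else_; _∨_; _∧_; not)
open import Data.Nat using (ℕ; zero; suc; _<_; _≤_)
import Data.Nat as ℕ
open import Data.Nat.Properties using () renaming (_≟_ to _≟ℕ_)
open import Data.Fin using (Fin) renaming (zero to fzero; suc to fsuc)
open import Data.Fin.Properties using () renaming (_≟_ to _≟F_)
open import Data.Fin.Subset using (Subset; _∈_; ∣_∣)
open import Data.Vec using (Vec; []; _∷_; tabulate; replicate; zipWith; toList)
import Data.Vec as Vec
open import Data.Vec.Properties using (≡-dec)
open import Data.List using (List; []; _∷_; _++_; map; concatMap; allFin)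
open import Data.Product using (_×_; _,_; proj₁; proj₂; ∃; ∃₂)
open import Data.Sum using (_⊎_)
open import Relation.Nullary using (¬_; does)
open import Relation.Binary.PropositionalEquality using (_≡_; _≢_)

record Field (c ℓ : Level) : Set (lsuc (c ⊔ ℓ)) where
  field
    commutativeRing : CommutativeRing c ℓ
  open CommutativeRing commutativeRing public
  field
    1≉0     : ¬ (1# ≈ 0#)
    inverse : ∀ x → ¬ (x ≈ 0#) → ∃ λ y → x * y ≈ 1#

module _ {c ℓ} (R : CommutativeRing c ℓ) where
  open CommutativeRing R
  natToRing : ℕ → Carrier
  natToRing zero    = 0#
  natToRing (suc n) = 1# + natToRing n

CharZero : ∀ {c ℓ} → Field c ℓ → Set ℓ
CharZero F = ∀ n → ¬ (natToRing commutativeRing (suc n) ≈ 0#)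
  where open Field F

-- A polynomial is represented by a finite list of terms
-- (coefficient, exponent vector); two polynomials are equal iff all their
-- coefficients agree (coefficients of repeated monomials are added).

module Poly {c ℓ} (R : CommutativeRing c ℓ) (m : ℕ) where
  open CommutativeRing R

  Mon : Set
  Mon = Vec ℕ m

  Pol : Set c
  Pol = List (Carrier × Mon)

  zeroP : Pol
  zeroP = []

  constP : Carrier → Pol
  constP a = (a , replicate m 0) ∷ []

  oneP : Pol
  oneP = constP 1#

  varP : Fin m → Pol
  varP e = (1# , tabulate (λ f → if does (e ≟F f) then 1 else 0)) ∷ []

  _+P_ : Pol → Pol → Pol
  p +P q = p ++ q

  _*P_ : Pol → Pol → Pol
  p *P q = concatMap (λ t → map (λ s → (proj₁ t * proj₁ s , zipWith ℕ._+_ (proj₂ t) (proj₂ s))) q) p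

  sumP : List Pol → Pol
  sumP []       = zeroP
  sumP (p ∷ ps) = p +P sumP ps

  coeff : Pol → Mon → Carrier
  coeff []             u = 0#
  coeff ((a , v) ∷ p)  u = if does (≡-dec _≟ℕ_ v u) then a + coeff p u else coeff p u

  _≈P_ : Pol → Pol → Set ℓ
  p ≈P q = ∀ u → coeff p u ≈ coeff q u

  totalDeg : Mon → ℕ
  totalDeg u = Vec.sum u

  DegreeAtMost : Pol → ℕ → Set ℓ
  DegreeAtMost p d = ∀ u → d < totalDeg u → coeff p u ≈ 0#

  HasDegree : Pol → ℕ → Set ℓ
  HasDegree p d = DegreeAtMost p d × ∃ λ u → totalDeg u ≡ d × ¬ (coeff p u ≈ 0#)

  pow : Carrier → ℕ → Carrier
  pow a zero    = 1#
  pow a (suc k) = a * pow a k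

  evalMon : ∀ {k} → Vec ℕ k → (Fin k → Carrier) → Carrier
  evalMon []      x = 1#
  evalMon (j ∷ u) x = pow (x fzero) j * evalMon u (λ i → x (fsuc i))

  eval : Pol → (Fin m → Carrier) → Carrier
  eval []            x = 0#
  eval ((a , u) ∷ p) x = a * evalMon u x + eval p x

-- Finite simple graphs on the vertex set Fin n, with the edges enumerated
-- as Fin m; edge e is the unordered pair {proj₁ (ends e), proj₂ (ends e)}.

SameEnds : ∀ {n} → Fin n × Fin n → Fin n × Fin n → Set
SameEnds (a , b) (c , d) = (a ≡ c × b ≡ d) ⊎ (a ≡ d × b ≡ c)

record SimpleGraph (n : ℕ) : Set where
  field
    m        : ℕ
    ends     : Fin m → Fin n × Fin n
    loopless : ∀ e → proj₁ (ends e) ≢ proj₂ (ends e)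
    noMulti  : ∀ e f → SameEnds (ends e) (ends f) → e ≡ f

module Graph {n : ℕ} (G : SimpleGraph n) where
  open SimpleGraph G public

  -- vertex i is an endpoint of edge e  (e = {i,j} with j ∈ N(i))
  Incident : Fin n → Fin m → Set
  Incident i e = proj₁ (ends e) ≡ i ⊎ proj₂ (ends e) ≡ i

  incident? : Fin n → Fin m → Bool
  incident? i e = does (proj₁ (ends e) ≟F i) ∨ does (proj₂ (ends e) ≟F i)

  -- edges e = {i,j}, f = {i,k} with j ≠ k, j,k ∈ N(i)  (equivalently e ≠ f)
  Valid : Fin n → Fin m → Fin m → Set
  Valid i e f = Incident i e × Incident i f × e ≢ f

  valid? : Fin n → Fin m → Fin m → Bool
  valid? i e f = incident? i e ∧ incident? i f ∧ not (does (e ≟F f))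

  ShareVertex : Fin m → Fin m → Set
  ShareVertex e f = ∃ λ v → Incident v e × Incident v f

  IsMatching : Subset m → Set
  IsMatching M = ∀ e f → e ∈ M → f ∈ M → e ≢ f → ¬ ShareVertex e f

  MaxMatchingSize : ℕ → Set
  MaxMatchingSize k = (∃ λ M → IsMatching M × ∣ M ∣ ≡ k)
                    × (∀ M → IsMatching M → ∣ M ∣ ≤ k)

  matchingMon : Subset m → Vec ℕ m
  matchingMon M = Vec.map (λ b → if b then 1 else 0) M

module Matching {c ℓ} (F : Field c ℓ) {n : ℕ} (G : SimpleGraph n) where
  open Field F using (Carrier; _≈_; 0#; 1#; -_; commutativeRing)
  open Graph G public
  open Poly commutativeRing m public

  sumFin : ∀ {k} → (Fin k → Pol) → Pol
  sumFin {k} g = sumP (map g (allFin k))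

  vertexPoly : Fin n → Pol
  vertexPoly i = sumFin (λ e → if incident? i e then varP e else zeroP) +P constP (- 1#)

  pairPoly : Fin m → Fin m → Pol
  pairPoly e f = varP e *P varP f

  Infeasible : Set (c ⊔ ℓ)
  Infeasible = ¬ (∃ λ (x : Fin m → Carrier) →
                    (∀ i → eval (vertexPoly i) x ≈ 0#)
                  × (∀ i e f → Valid i e f → eval (pairPoly e f) x ≈ 0#))

  -- 1 = Σ_i Δ_i (Σ_{j∈N(i)} x_ij − 1) + Σ_{i, j≠k} Θ^i_{jk} x_ij x_ik
  -- (Θ i e f is Θ^i_{jk} for e = {i,j}, f = {i,k}; other values unused)
  IsCertificate : (Fin n → Pol) → (Fin n → Fin m → Fin m → Pol) → Set ℓ
  IsCertificate Δ Θ =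
    oneP ≈P (sumFin (λ i → Δ i *P vertexPoly i)
             +P sumFin (λ i → sumFin (λ e → sumFin (λ f →
                  if valid? i e f then Θ i e f *P pairPoly e f else zeroP))))

module Submission where

open import Defs
open import Algebra.Bundles using (CommutativeRing)
open import Data.Bool using (Bool; true; false; if_then_else_; not)
open import Data.Bool.Properties using (T-≡) renaming (_≟_ to _≟B_)
open import Data.Nat as ℕ using (ℕ; zero; suc; _≤ᵇ_; _∸_)
import Data.Nat.Properties as ℕP
open import Data.Integer as ℤ using (ℤ; -[1+_]; _⊖_)
import Data.Integer.Properties as ℤP
import Data.Sign as Sign
open import Data.Fin using (Fin) renaming (zero to fzero; suc to fsuc)
open import Data.Fin.Properties using (suc-injective; all?; any?; ¬∀⟶∃¬) renaming (_≟_ to _≟F_)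
open import Data.Fin.Subset using (Subset; ∣_∣; _∈_; _⊆_; ⊥)
open import Data.Fin.Subset.Properties using (_∈?_; ∉⊥; ∣⊥∣≡0; x∈p⇒∣p-x∣<∣p∣)
open import Data.Vec as Vec using (Vec; []; _∷_; zipWith; tabulate; replicate; lookup; _[_]≔_)
open import Data.Vec.Properties
  using (≡-dec; ∷-injectiveˡ; ∷-injectiveʳ; lookup∘tabulate; lookup∘update; lookup∘update′;
         []≔-idempotent; []≔-lookup; lookup⇒[]=; []=⇒lookup)
open import Data.List as List using ([]; _∷_; _++_; map)
import Data.List.Properties as ListP
open import Data.Maybe as Maybe using (Maybe; just; nothing; maybe′; _>>=_)
open import Data.Maybe.Properties using (just-injective)
open import Data.Product using (_×_; _,_; proj₁; proj₂; ∃; ∃₂)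
open import Data.Sum using (inj₁; inj₂; [_,_])
open import Data.Empty using (⊥-elim)
open import Function using (_∘_; Equivalence; _⇔_; mk⇔)
open import Relation.Nullary using (Dec; yes; no; does; ¬_)
open import Relation.Nullary.Decidable using (dec-true; dec-false; does-⇔; _→-dec_; _⊎-dec_; _×-dec_; ¬?)
open import Relation.Binary.PropositionalEquality as ≡ using (_≡_; _≢_)

-- The certificate is written down explicitly.  Orient every edge by `ends`,
-- let a_0 = 1/n and a_{k+1} = (2k+2) a_k / (n − 2k − 2), and put
--   Δ_v = Σ_M D(v,M) x^M  over the matchings M, where D(v,M) = −a_{|M|} if v is
--         uncovered by M and ∓1 if v is the source/target of its M-edge;
--   Θ^v_{ef} = Σ_{N ∌ f} H(v,e,N ∪ {f}) x^N,  H(v,e,M) = −(D(v,M) + (1 − χ_M(w)) D(w,M)),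
-- with w the other end of e and χ_M(w) = [w is covered by M].  Infeasibility
-- means no matching is perfect, so 2|M| < n; hence every a_{|M|} is defined and
-- nonzero, which gives (a)–(c).  The identity is checked coefficientwise: for
-- e ∉ M the terms at x^M x_e sum to −2a_{|M|} [M ∪ {e} is a matching]
-- (Z-insert), so the coefficient of x^S is |S|(−2a_{|S|−1}) + a_{|S|}(n − 2|S|),
-- which the recursion for a_k makes [S = ∅] (coeff-square-free).

module IntegerCoefficients {c ℓ} (R : CommutativeRing c ℓ) where
  open CommutativeRing R
  open import Algebra.Properties.Ring ring
    using (-‿involutive; -0#≈0#; -‿distribˡ-*; -‿distribʳ-*; -‿+-comm)
  open import Algebra.Properties.Semiring.Mult.TCOptimised semiring
    using (1+×; ×-homo-+; ×1-homo-*) renaming (_×_ to _×′_)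
  open import Algebra.Properties.CommutativeSemigroup +-commutativeSemigroup using (interchange)
  open import Relation.Binary.Reasoning.Setoid setoid
  import Algebra.Solver.Ring as RingSolver
  import Algebra.Solver.Ring.AlmostCommutativeRing as ACR

  -- n · 1 in R; the optimised multiple has nat 1 = 1# definitionally,
  -- which the solver needs to identify the coefficient 1 with 1#
  nat : ℕ → Carrier
  nat n = n ×′ 1#

  nat-suc : ∀ n → nat (suc n) ≈ 1# + nat n
  nat-suc n = 1+× n 1#

  nat-+ : ∀ m n → nat (m ℕ.+ n) ≈ nat m + nat n
  nat-+ = ×-homo-+ 1#

  nat-* : ∀ m n → nat (m ℕ.* n) ≈ nat m * nat n
  nat-* = ×1-homo-*

  natToRing≈nat : ∀ n → natToRing R n ≈ nat n
  natToRing≈nat zero    = refl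
  natToRing≈nat (suc n) = trans (+-congˡ (natToRing≈nat n)) (sym (nat-suc n))

  ι : ℤ → Carrier
  ι (ℤ.+ n)      = nat n
  ι -[1+ n ]   = - nat (suc n)

  ι-⊖ : ∀ m n → ι (m ⊖ n) ≈ nat m - nat n
  ι-⊖ zero    zero    = sym (trans (+-identityˡ _) -0#≈0#)
  ι-⊖ zero    (suc n) = sym (+-identityˡ _)
  ι-⊖ (suc m) zero    = sym (trans (+-congˡ -0#≈0#) (+-identityʳ _))
  ι-⊖ (suc m) (suc n) rewrite ℤP.[1+m]⊖[1+n]≡m⊖n m n = begin
    ι (m ⊖ n)                          ≈⟨ ι-⊖ m n ⟩
    nat m - nat n                      ≈⟨ +-identityˡ _ ⟨
    0# + (nat m - nat n)               ≈⟨ +-congʳ (-‿inverseʳ 1#) ⟨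
    (1# - 1#) + (nat m - nat n)        ≈⟨ interchange 1# (- 1#) (nat m) (- nat n) ⟩
    (1# + nat m) + (- 1# - nat n)      ≈⟨ +-congˡ (-‿+-comm 1# (nat n)) ⟩
    (1# + nat m) - (1# + nat n)        ≈⟨ +-cong (nat-suc m) (-‿cong (nat-suc n)) ⟨
    nat (suc m) - nat (suc n)          ∎

  ι-+ : ∀ i j → ι (i ℤ.+ j) ≈ ι i + ι j
  ι-+ (ℤ.+ m)      (ℤ.+ n)      = nat-+ m n
  ι-+ (ℤ.+ m)      -[1+ n ]   = ι-⊖ m (suc n)
  ι-+ -[1+ m ]   (ℤ.+ n)      = trans (ι-⊖ n (suc m)) (+-comm _ _)
  ι-+ -[1+ m ]   -[1+ n ]   = begin
    - nat (suc (suc (m ℕ.+ n)))     ≈⟨ -‿cong (reflexive (≡.cong (λ k → nat (suc k)) (ℕP.+-suc m n))) ⟨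
    - nat (suc m ℕ.+ suc n)         ≈⟨ -‿cong (nat-+ (suc m) (suc n)) ⟩
    - (nat (suc m) + nat (suc n))   ≈⟨ -‿+-comm _ _ ⟨
    - nat (suc m) - nat (suc n)     ∎

  ι-neg : ∀ i → ι (ℤ.- i) ≈ - ι i
  ι-neg (ℤ.+ zero)   = sym -0#≈0#
  ι-neg (ℤ.+ suc n)  = refl
  ι-neg -[1+ n ]   = sym (-‿involutive _)

  ι-◃⁺ : ∀ k → ι (Sign.+ ℤ.◃ k) ≈ nat k
  ι-◃⁺ zero    = refl
  ι-◃⁺ (suc k) = refl

  ι-◃⁻ : ∀ k → ι (Sign.- ℤ.◃ k) ≈ - nat k
  ι-◃⁻ zero    = sym -0#≈0#
  ι-◃⁻ (suc k) = refl

  ι-* : ∀ i j → ι (i ℤ.* j) ≈ ι i * ι j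
  ι-* (ℤ.+ m)      (ℤ.+ n)      = trans (ι-◃⁺ (m ℕ.* n)) (nat-* m n)
  ι-* (ℤ.+ m)      -[1+ n ]   =
    trans (ι-◃⁻ (m ℕ.* suc n)) (trans (-‿cong (nat-* m (suc n))) (-‿distribʳ-* _ _))
  ι-* -[1+ m ]   (ℤ.+ n)      =
    trans (ι-◃⁻ (suc m ℕ.* n)) (trans (-‿cong (nat-* (suc m) n)) (-‿distribˡ-* _ _))
  ι-* -[1+ m ]   -[1+ n ]   = begin
    ι (Sign.+ ℤ.◃ (suc m ℕ.* suc n))    ≈⟨ ι-◃⁺ (suc m ℕ.* suc n) ⟩
    nat (suc m ℕ.* suc n)               ≈⟨ nat-* (suc m) (suc n) ⟩
    nat (suc m) * nat (suc n)           ≈⟨ -‿involutive _ ⟨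
    - - (nat (suc m) * nat (suc n))     ≈⟨ -‿cong (-‿distribˡ-* _ _) ⟩
    - ((- nat (suc m)) * nat (suc n))   ≈⟨ -‿distribʳ-* _ _ ⟩
    (- nat (suc m)) * (- nat (suc n))   ∎

  ι-homomorphism : ACR._-Raw-AlmostCommutative⟶_ ℤ.+-*-rawRing (ACR.fromCommutativeRing R)
  ι-homomorphism = record
    { ⟦_⟧ = ι ; +-homo = ι-+ ; *-homo = ι-* ; -‿homo = ι-neg
    ; 0-homo = refl ; 1-homo = refl }

  ι-≟ : ∀ i j → Maybe (ι i ≈ ι j)
  ι-≟ i j with i ℤ.≟ j
  ... | yes ≡.refl = just refl
  ... | no _       = nothing

  open RingSolver ℤ.+-*-rawRing (ACR.fromCommutativeRing R) ι-homomorphism ι-≟ public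
    using (solve; _:+_; _:*_; :-_; _:-_; con; _:=_)

module Sums {c ℓ} (R : CommutativeRing c ℓ) where
  open CommutativeRing R
  open import Algebra.Properties.Ring ring using (-0#≈0#; -‿+-comm)
  open import Algebra.Properties.Semiring.Sum semiring public
    using (sum; sum-cong-≋; ∑-distrib-+; ∑-comm; *-distribˡ-sum; *-distribʳ-sum)
  open import Algebra.Properties.Semiring.Sum semiring using (sum-replicate-zero)
  open import Relation.Binary.Reasoning.Setoid setoid
  open IntegerCoefficients R using (nat; nat-suc)

  sum-zero : ∀ {k} {f : Fin k → Carrier} → (∀ i → f i ≈ 0#) → sum f ≈ 0#
  sum-zero {k} f≈0 = trans (sum-cong-≋ f≈0) (sum-replicate-zero k)

  sum-neg : ∀ {k} (f : Fin k → Carrier) → sum (λ i → - f i) ≈ - sum f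
  sum-neg {zero}  f = sym -0#≈0#
  sum-neg {suc k} f = trans (+-congˡ (sum-neg (f ∘ fsuc))) (-‿+-comm _ _)

  sum-ones : ∀ k → sum {k} (λ _ → 1#) ≈ nat k
  sum-ones zero    = refl
  sum-ones (suc k) = trans (+-congˡ (sum-ones k)) (sym (nat-suc k))

  sum-single : ∀ {k} {f : Fin k → Carrier} (a : Fin k) →
               (∀ i → i ≢ a → f i ≈ 0#) → sum f ≈ f a
  sum-single fzero    f≈0 =
    trans (+-congˡ (sum-zero (λ i → f≈0 (fsuc i) λ ()))) (+-identityʳ _)
  sum-single (fsuc a) f≈0 =
    trans (+-cong (f≈0 fzero λ ()) (sum-single a λ i i≢a → f≈0 (fsuc i) (i≢a ∘ suc-injective)))
          (+-identityˡ _)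

  sum-pair : ∀ {k} {f : Fin k → Carrier} (a b : Fin k) → a ≢ b →
             (∀ i → i ≢ a → i ≢ b → f i ≈ 0#) → sum f ≈ f a + f b
  sum-pair {f = f} a b a≢b f≈0 = begin
    sum f                       ≈⟨ sum-cong-≋ split ⟩
    sum (λ i → at a i + at b i) ≈⟨ ∑-distrib-+ (at a) (at b) ⟩
    sum (at a) + sum (at b)     ≈⟨ +-cong (sum-single a (at-off a)) (sum-single b (at-off b)) ⟩
    at a a + at b b             ≈⟨ +-cong (at-on a) (at-on b) ⟩
    f a + f b                   ∎
    where
    at : Fin _ → Fin _ → Carrier
    at j i = if does (i ≟F j) then f i else 0#
    at-on : ∀ j → at j j ≈ f j
    at-on j rewrite dec-true (j ≟F j) ≡.refl = refl
    at-off : ∀ j i → i ≢ j → at j i ≈ 0#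
    at-off j i i≢j rewrite dec-false (i ≟F j) i≢j = refl
    split : ∀ i → f i ≈ at a i + at b i
    split i with i ≟F a | i ≟F b
    ... | yes ≡.refl | yes ≡.refl = ⊥-elim (a≢b ≡.refl)
    ... | yes _      | no _       = sym (+-identityʳ _)
    ... | no _       | yes _      = sym (+-identityˡ _)
    ... | no i≢a     | no i≢b     = trans (f≈0 i i≢a i≢b) (sym (+-identityˡ _))

  ind : Bool → Carrier
  ind b = if b then 1# else 0#

  sum-indicator : ∀ {k} (S : Subset k) → sum (λ e → ind (Vec.lookup S e)) ≈ nat ∣ S ∣
  sum-indicator []          = refl
  sum-indicator (true ∷ S)  = trans (+-congˡ (sum-indicator S)) (sym (nat-suc ∣ S ∣))
  sum-indicator (false ∷ S) = trans (+-identityˡ _) (sum-indicator S)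

module Monomials where

  zeros : ∀ {k} → Vec ℕ k
  zeros {k} = replicate k 0

  zeros-tabulate : ∀ {k} → tabulate {n = k} (λ _ → 0) ≡ zeros
  zeros-tabulate {zero}  = ≡.refl
  zeros-tabulate {suc k} = ≡.cong (0 ∷_) zeros-tabulate

  unit : ∀ {k} → Fin k → Vec ℕ k
  unit e = tabulate (λ f → if does (e ≟F f) then 1 else 0)

  infixl 6 _+ᵥ_ _∸ᵥ_

  _+ᵥ_ : ∀ {k} → Vec ℕ k → Vec ℕ k → Vec ℕ k
  _+ᵥ_ = zipWith ℕ._+_

  -- u ∸ᵥ w is the exponent vector of x^u / x^w, if x^w divides x^u
  _∸ᵥ_ : ∀ {k} → Vec ℕ k → Vec ℕ k → Maybe (Vec ℕ k)
  []      ∸ᵥ []      = just []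
  (x ∷ u) ∸ᵥ (y ∷ w) = if y ≤ᵇ x then Maybe.map (x ∸ y ∷_) (u ∸ᵥ w) else nothing

  ≤ᵇ-true : ∀ {m n} → m ℕ.≤ n → (m ≤ᵇ n) ≡ true
  ≤ᵇ-true m≤n = Equivalence.to T-≡ (ℕP.≤⇒≤ᵇ m≤n)

  ≤ᵇ-sound : ∀ {m n} → (m ≤ᵇ n) ≡ true → m ℕ.≤ n
  ≤ᵇ-sound {m} {n} eq = ℕP.≤ᵇ⇒≤ m n (Equivalence.from T-≡ eq)

  ∸ᵥ-complete : ∀ {k} (v w : Vec ℕ k) → v +ᵥ w ∸ᵥ w ≡ just v
  ∸ᵥ-complete []      []      = ≡.refl
  ∸ᵥ-complete (x ∷ v) (y ∷ w)
    rewrite ≤ᵇ-true (ℕP.m≤n+m y x) | ℕP.m+n∸n≡m x y | ∸ᵥ-complete v w = ≡.refl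

  ∸ᵥ-sound : ∀ {k} (u w d : Vec ℕ k) → u ∸ᵥ w ≡ just d → d +ᵥ w ≡ u
  ∸ᵥ-sound []      []      [] _ = ≡.refl
  ∸ᵥ-sound (x ∷ u) (y ∷ w) d eq with y ≤ᵇ x in y≤x | u ∸ᵥ w in u∸w
  ∸ᵥ-sound (x ∷ u) (y ∷ w) _ ≡.refl | true | just d =
    ≡.cong₂ _∷_ (ℕP.m∸n+n≡m {x} {y} (≤ᵇ-sound y≤x)) (∸ᵥ-sound u w d u∸w)

  ∸ᵥ-nothing : ∀ {k} (v w u : Vec ℕ k) → u ∸ᵥ w ≡ nothing → v +ᵥ w ≢ u
  ∸ᵥ-nothing v w u u∸w ≡.refl with () ← ≡.trans (≡.sym u∸w) (∸ᵥ-complete v w)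

  ∸ᵥ-just : ∀ {k} (v w u d : Vec ℕ k) → u ∸ᵥ w ≡ just d → (v +ᵥ w ≡ u) ⇔ (v ≡ d)
  ∸ᵥ-just v w u d u∸w = mk⇔
    (λ { ≡.refl → just-injective (≡.trans (≡.sym (∸ᵥ-complete v w)) u∸w) })
    (λ { ≡.refl → ∸ᵥ-sound u w d u∸w })

  +ᵥ-shuffle : ∀ {k} (d w₁ w₂ : Vec ℕ k) → d +ᵥ (w₁ +ᵥ w₂) ≡ (d +ᵥ w₂) +ᵥ w₁
  +ᵥ-shuffle []      []        []        = ≡.refl
  +ᵥ-shuffle (x ∷ d) (y₁ ∷ w₁) (y₂ ∷ w₂) = ≡.cong₂ _∷_ shuffle (+ᵥ-shuffle d w₁ w₂)
    where
    shuffle : x ℕ.+ (y₁ ℕ.+ y₂) ≡ x ℕ.+ y₂ ℕ.+ y₁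
    shuffle = ≡.trans (≡.cong (x ℕ.+_) (ℕP.+-comm y₁ y₂)) (≡.sym (ℕP.+-assoc x y₂ y₁))

  ∸ᵥ-+-first : ∀ {k} (u w₁ w₂ d : Vec ℕ k) →
               u ∸ᵥ (w₁ +ᵥ w₂) ≡ just d → u ∸ᵥ w₁ ≡ just (d +ᵥ w₂)
  ∸ᵥ-+-first u w₁ w₂ d eq
    rewrite ≡.sym (∸ᵥ-sound u (w₁ +ᵥ w₂) d eq) | +ᵥ-shuffle d w₁ w₂ = ∸ᵥ-complete (d +ᵥ w₂) w₁

  ∸ᵥ-+-both : ∀ {k} (u w₁ w₂ d₁ d : Vec ℕ k) →
              u ∸ᵥ w₁ ≡ just d₁ → d₁ ∸ᵥ w₂ ≡ just d → u ∸ᵥ (w₁ +ᵥ w₂) ≡ just d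
  ∸ᵥ-+-both u w₁ w₂ d₁ d q₁ q₂
    rewrite ≡.sym (∸ᵥ-sound u w₁ d₁ q₁) | ≡.sym (∸ᵥ-sound d₁ w₂ d q₂)
          | ≡.sym (+ᵥ-shuffle d w₁ w₂) = ∸ᵥ-complete d (w₁ +ᵥ w₂)

  ∸ᵥ-+ : ∀ {k} (u w₁ w₂ : Vec ℕ k) → u ∸ᵥ (w₁ +ᵥ w₂) ≡ (u ∸ᵥ w₁ >>= _∸ᵥ w₂)
  ∸ᵥ-+ u w₁ w₂ with u ∸ᵥ (w₁ +ᵥ w₂) in q
  ... | just d rewrite ∸ᵥ-+-first u w₁ w₂ d q = ≡.sym (∸ᵥ-complete d w₂)
  ... | nothing with u ∸ᵥ w₁ in q₁
  ...   | nothing = ≡.refl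
  ...   | just d₁ with d₁ ∸ᵥ w₂ in q₂
  ...     | nothing = ≡.refl
  ...     | just d with () ← ≡.trans (≡.sym q) (∸ᵥ-+-both u w₁ w₂ d₁ d q₁ q₂)

  ∸ᵥ-zeros : ∀ {k} (u : Vec ℕ k) → u ∸ᵥ zeros ≡ just u
  ∸ᵥ-zeros []      = ≡.refl
  ∸ᵥ-zeros (x ∷ u) rewrite ∸ᵥ-zeros u = ≡.refl

  bit : Bool → ℕ
  bit b = if b then 1 else 0

  monomial : ∀ {k} → Subset k → Vec ℕ k
  monomial = Vec.map bit

  decode : ∀ {k} → Vec ℕ k → Maybe (Subset k)
  decode []                = just []
  decode (0 ∷ u)           = Maybe.map (false ∷_) (decode u)
  decode (1 ∷ u)           = Maybe.map (true ∷_) (decode u)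
  decode (suc (suc _) ∷ u) = nothing

  decode-monomial : ∀ {k} (S : Subset k) → decode (monomial S) ≡ just S
  decode-monomial []        = ≡.refl
  decode-monomial (true ∷ S)  rewrite decode-monomial S = ≡.refl
  decode-monomial (false ∷ S) rewrite decode-monomial S = ≡.refl

  decode-just : ∀ {k} (u : Vec ℕ k) {S} → decode u ≡ just S → u ≡ monomial S
  decode-just []            ≡.refl = ≡.refl
  decode-just (0 ∷ u)       eq with decode u in du
  decode-just (0 ∷ u) ≡.refl | just S = ≡.cong (0 ∷_) (decode-just u du)
  decode-just (1 ∷ u)       eq with decode u in du
  decode-just (1 ∷ u) ≡.refl | just S = ≡.cong (1 ∷_) (decode-just u du)

  degree-monomial : ∀ {k} (S : Subset k) → Vec.sum (monomial S) ≡ ∣ S ∣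
  degree-monomial []          = ≡.refl
  degree-monomial (true ∷ S)  = ≡.cong suc (degree-monomial S)
  degree-monomial (false ∷ S) = degree-monomial S

  degree-decode : ∀ {k} (u : Vec ℕ k) {S} → decode u ≡ just S → Vec.sum u ≡ ∣ S ∣
  degree-decode u {S} u≡ = ≡.trans (≡.cong Vec.sum (decode-just u u≡)) (degree-monomial S)

  monomial-empty : ∀ {k} (S : Subset k) → ∣ S ∣ ≡ 0 → monomial S ≡ zeros
  monomial-empty []          _  = ≡.refl
  monomial-empty (false ∷ S) eq = ≡.cong (0 ∷_) (monomial-empty S eq)

  ∣insert∣ : ∀ {k} (S : Subset k) e → lookup S e ≡ false → ∣ S [ e ]≔ true ∣ ≡ suc ∣ S ∣
  ∣insert∣ (false ∷ S) fzero    _  = ≡.refl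
  ∣insert∣ (true ∷ S)  (fsuc e) eq = ≡.cong suc (∣insert∣ S e eq)
  ∣insert∣ (false ∷ S) (fsuc e) eq = ∣insert∣ S e eq

  +ᵥ-tabulate-zero : ∀ {k} (u : Vec ℕ k) → u +ᵥ tabulate (λ _ → 0) ≡ u
  +ᵥ-tabulate-zero []      = ≡.refl
  +ᵥ-tabulate-zero (x ∷ u) = ≡.cong₂ _∷_ (ℕP.+-identityʳ x) (+ᵥ-tabulate-zero u)

  monomial-insert : ∀ {k} (S : Subset k) e → lookup S e ≡ false →
                    monomial S +ᵥ unit e ≡ monomial (S [ e ]≔ true)
  monomial-insert (false ∷ S) fzero    _  = ≡.cong (1 ∷_) (+ᵥ-tabulate-zero (monomial S))
  monomial-insert (b ∷ S)     (fsuc e) eq =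
    ≡.cong₂ _∷_ (ℕP.+-identityʳ (bit b)) (monomial-insert S e eq)

  reinsert : ∀ {k} (S : Subset k) e → lookup S e ≡ true → S [ e ]≔ false [ e ]≔ true ≡ S
  reinsert S e e∈S =
    ≡.trans ([]≔-idempotent S e) (≡.trans (≡.cong (S [ e ]≔_) (≡.sym e∈S)) ([]≔-lookup S e))

  ∸ᵥ-unit-present : ∀ {k} (S : Subset k) e → lookup S e ≡ true →
                    monomial S ∸ᵥ unit e ≡ just (monomial (S [ e ]≔ false))
  ∸ᵥ-unit-present S e e∈S = begin
    monomial S ∸ᵥ unit e
      ≡⟨ ≡.cong (λ T → monomial T ∸ᵥ unit e) (reinsert S e e∈S) ⟨
    monomial (S′ [ e ]≔ true) ∸ᵥ unit e
      ≡⟨ ≡.cong (_∸ᵥ unit e) (monomial-insert S′ e (lookup∘update e S false)) ⟨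
    monomial S′ +ᵥ unit e ∸ᵥ unit e
      ≡⟨ ∸ᵥ-complete (monomial S′) (unit e) ⟩
    just (monomial S′) ∎
    where
    open ≡.≡-Reasoning
    S′ = S [ e ]≔ false

  ∸ᵥ-unit-absent : ∀ {k} (S : Subset k) e → lookup S e ≡ false → monomial S ∸ᵥ unit e ≡ nothing
  ∸ᵥ-unit-absent (false ∷ S) fzero    _  = ≡.refl
  ∸ᵥ-unit-absent (b ∷ S)     (fsuc e) eq rewrite ∸ᵥ-unit-absent S e eq = ≡.refl

  monomial-zeros : ∀ {k} (S : Subset k) → monomial S ≡ zeros → S ≡ ⊥
  monomial-zeros []          _  = ≡.refl
  monomial-zeros (false ∷ S) eq = ≡.cong (false ∷_) (monomial-zeros S (∷-injectiveʳ eq))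
  monomial-zeros (true ∷ S)  eq with () ← ∷-injectiveˡ eq

  decode-multiple : ∀ {k} (d d′ : Vec ℕ k) f {N} → d ∸ᵥ unit f ≡ just d′ → decode d′ ≡ just N →
                    lookup N f ≡ false → decode d ≡ just (N [ f ]≔ true)
  decode-multiple d d′ f {N} d∸f d′≡N f∉N =
    ≡.trans (≡.cong decode d≡N∪f) (decode-monomial (N [ f ]≔ true))
    where
    d≡N∪f : d ≡ monomial (N [ f ]≔ true)
    d≡N∪f = ≡.trans (≡.sym (∸ᵥ-sound d (unit f) d′ d∸f))
      (≡.trans (≡.cong (_+ᵥ unit f) (decode-just d′ d′≡N)) (monomial-insert N f f∉N))

  decode-zeros : ∀ {k} → decode (zeros {k}) ≡ just ⊥
  decode-zeros {k} = ≡.trans (≡.cong decode (≡.sym (monomial-empty ⊥ (∣⊥∣≡0 k)))) (decode-monomial ⊥)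

module Coefficients {c ℓ} (R : CommutativeRing c ℓ) where
  open CommutativeRing R
  open Sums R
  open Monomials
  open import Algebra.Properties.CommutativeSemigroup +-commutativeSemigroup using (interchange)
  open import Relation.Binary.Reasoning.Setoid setoid
  module P {k : ℕ} = Poly R k
  open P using (Pol; coeff; _*P_; sumP)

  coeff-++ : ∀ {k} (p q : Pol {k}) u → coeff (p ++ q) u ≈ coeff p u + coeff q u
  coeff-++ []            q u = sym (+-identityˡ _)
  coeff-++ ((a , v) ∷ p) q u with does (≡-dec ℕ._≟_ v u)
  ... | true  = trans (+-congˡ (coeff-++ p q u)) (sym (+-assoc _ _ _))
  ... | false = coeff-++ p q u

  coeff-sumP : ∀ {k j} {A : Set} (g : A → Pol {k}) (h : Fin j → A) u →
               coeff (sumP (map g (List.tabulate h))) u ≈ sum (λ i → coeff (g (h i)) u)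
  coeff-sumP {j = zero}  g h u = refl
  coeff-sumP {j = suc j} g h u = trans (coeff-++ (g (h fzero)) _ u) (+-congˡ (coeff-sumP g (h ∘ fsuc) u))

  coeff-sumFin : ∀ {k j} (g : Fin j → Pol {k}) u →
                 coeff (sumP (map g (List.allFin j))) u ≈ sum (λ i → coeff (g i) u)
  coeff-sumFin g = coeff-sumP g (λ i → i)

  coeff-*-term : ∀ {k} (p : Pol {k}) b w u →
                 coeff (p *P ((b , w) ∷ [])) u ≈ maybe′ (λ d → coeff p d * b) 0# (u ∸ᵥ w)
  coeff-*-term [] b w u with u ∸ᵥ w
  ... | just _  = sym (zeroˡ b)
  ... | nothing = refl
  coeff-*-term ((a , v) ∷ p) b w u with u ∸ᵥ w in u∸w | coeff-*-term p b w u
  ... | nothing | ih rewrite dec-false (≡-dec ℕ._≟_ (v +ᵥ w) u) (∸ᵥ-nothing v w u u∸w) = ih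
  ... | just d  | ih
    rewrite does-⇔ (∸ᵥ-just v w u d u∸w) (≡-dec ℕ._≟_ (v +ᵥ w) u) (≡-dec ℕ._≟_ v d)
    with does (≡-dec ℕ._≟_ v d)
  ...   | true  = trans (+-congˡ ih) (sym (distribʳ _ _ _))
  ...   | false = ih

  coeff-*-[] : ∀ {k} (p : Pol {k}) u → coeff (p *P []) u ≈ 0#
  coeff-*-[] []      u = refl
  coeff-*-[] (_ ∷ p) u = coeff-*-[] p u

  coeff-*-++ : ∀ {k} (p q₁ q₂ : Pol {k}) u →
               coeff (p *P (q₁ ++ q₂)) u ≈ coeff (p *P q₁) u + coeff (p *P q₂) u
  coeff-*-++ []      q₁ q₂ u = sym (+-identityˡ _)
  coeff-*-++ (t ∷ p) q₁ q₂ u = begin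
    coeff (map f (q₁ ++ q₂) ++ p *P (q₁ ++ q₂)) u
      ≈⟨ coeff-++ (map f (q₁ ++ q₂)) _ u ⟩
    coeff (map f (q₁ ++ q₂)) u + coeff (p *P (q₁ ++ q₂)) u
      ≈⟨ +-cong (reflexive (≡.cong (λ r → coeff r u) (ListP.map-++ f q₁ q₂))) (coeff-*-++ p q₁ q₂ u) ⟩
    coeff (map f q₁ ++ map f q₂) u + (coeff (p *P q₁) u + coeff (p *P q₂) u)
      ≈⟨ +-congʳ (coeff-++ (map f q₁) _ u) ⟩
    (coeff (map f q₁) u + coeff (map f q₂) u) + (coeff (p *P q₁) u + coeff (p *P q₂) u)
      ≈⟨ interchange _ _ _ _ ⟩
    (coeff (map f q₁) u + coeff (p *P q₁) u) + (coeff (map f q₂) u + coeff (p *P q₂) u)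
      ≈⟨ +-cong (coeff-++ (map f q₁) _ u) (coeff-++ (map f q₂) _ u) ⟨
    coeff ((t ∷ p) *P q₁) u + coeff ((t ∷ p) *P q₂) u ∎
    where
    f = λ s → (proj₁ t * proj₁ s , proj₂ t +ᵥ proj₂ s)

  coeff-*-sumFin : ∀ {k j} (p : Pol {k}) (g : Fin j → Pol {k}) u →
                   coeff (p *P sumP (map g (List.allFin j))) u ≈ sum (λ i → coeff (p *P g i) u)
  coeff-*-sumFin p g u = go g (λ i → i)
    where
    go : ∀ {j} {A : Set} (g : A → Pol) (h : Fin j → A) →
         coeff (p *P sumP (map g (List.tabulate h))) u ≈ sum (λ i → coeff (p *P g (h i)) u)
    go {zero}  g h = coeff-*-[] p u
    go {suc j} g h = trans (coeff-*-++ p (g (h fzero)) _ u) (+-congˡ (go g (h ∘ fsuc)))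

  -- the coefficient function of Σ_S h(S) x^S: h on square-free monomials, 0 elsewhere
  extend : ∀ {k} → (Subset k → Carrier) → Vec ℕ k → Carrier
  extend h u = maybe′ h 0# (decode u)

  extend-monomial : ∀ {k} (h : Subset k → Carrier) S → extend h (monomial S) ≡ h S
  extend-monomial h S = ≡.cong (maybe′ h 0#) (decode-monomial S)

  prepend : ∀ {k} → ℕ → Carrier × Vec ℕ k → Carrier × Vec ℕ (suc k)
  prepend x (a , v) = (a , x ∷ v)

  coeff-prepend : ∀ {k} x y (p : Pol {k}) u →
                  coeff (map (prepend x) p) (y ∷ u) ≈ (if does (x ℕ.≟ y) then coeff p u else 0#)
  coeff-prepend x y []            u with does (x ℕ.≟ y)
  ... | true  = refl
  ... | false = refl
  coeff-prepend x y ((a , v) ∷ p) u with does (x ℕ.≟ y) | coeff-prepend x y p u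
  ... | false | ih = ih
  ... | true  | ih with does (≡-dec ℕ._≟_ v u)
  ...   | true  = +-congˡ ih
  ...   | false = ih

  subsetPoly : ∀ {k} → (Subset k → Carrier) → Pol {k}
  subsetPoly {zero}  h = (h [] , []) ∷ []
  subsetPoly {suc k} h = map (prepend 0) (subsetPoly (h ∘ (false ∷_)))
                      ++ map (prepend 1) (subsetPoly (h ∘ (true ∷_)))

  coeff-subsetPoly : ∀ {k} (h : Subset k → Carrier) u → coeff (subsetPoly h) u ≈ extend h u
  coeff-subsetPoly {zero}  h []      = +-identityʳ _
  coeff-subsetPoly {suc k} h (x ∷ u) = begin
    coeff (map (prepend 0) P₀ ++ map (prepend 1) P₁) (x ∷ u)
      ≈⟨ coeff-++ (map (prepend 0) P₀) _ _ ⟩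
    coeff (map (prepend 0) P₀) (x ∷ u) + coeff (map (prepend 1) P₁) (x ∷ u)
      ≈⟨ +-cong (coeff-prepend 0 x P₀ u) (coeff-prepend 1 x P₁ u) ⟩
    (if does (0 ℕ.≟ x) then coeff P₀ u else 0#) + (if does (1 ℕ.≟ x) then coeff P₁ u else 0#)
      ≈⟨ by-first-exponent x ⟩
    extend h (x ∷ u) ∎
    where
    P₀ = subsetPoly (h ∘ (false ∷_))
    P₁ = subsetPoly (h ∘ (true ∷_))
    extend-∷ : ∀ b → extend (h ∘ (b ∷_)) u ≡ maybe′ h 0# (Maybe.map (b ∷_) (decode u))
    extend-∷ b with decode u
    ... | just _  = ≡.refl
    ... | nothing = ≡.refl
    by-first-exponent : ∀ x → (if does (0 ℕ.≟ x) then coeff P₀ u else 0#)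
                              + (if does (1 ℕ.≟ x) then coeff P₁ u else 0#) ≈ extend h (x ∷ u)
    by-first-exponent 0 =
      trans (+-identityʳ _) (trans (coeff-subsetPoly _ u) (reflexive (extend-∷ false)))
    by-first-exponent 1 =
      trans (+-identityˡ _) (trans (coeff-subsetPoly _ u) (reflexive (extend-∷ true)))
    by-first-exponent (suc (suc _)) = +-identityˡ _

  coeff-subsetPoly-monomial : ∀ {k} (h : Subset k → Carrier) S → coeff (subsetPoly h) (monomial S) ≈ h S
  coeff-subsetPoly-monomial h S = trans (coeff-subsetPoly h (monomial S)) (reflexive (extend-monomial h S))

  maybe′-cong : ∀ {A : Set} {g h : A → Carrier} → (∀ x → g x ≈ h x) →
                ∀ mx → maybe′ g 0# mx ≈ maybe′ h 0# mx
  maybe′-cong g≈h (just x) = g≈h x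
  maybe′-cong g≈h nothing  = refl

  coeff-constP-zeros : ∀ {k} b → coeff (P.constP {k} b) zeros ≈ b
  coeff-constP-zeros {k} b rewrite dec-true (≡-dec ℕ._≟_ (zeros {k}) zeros) ≡.refl = +-identityʳ b

  coeff-constP-other : ∀ {k} b {u : Vec ℕ k} → zeros ≢ u → coeff (P.constP b) u ≈ 0#
  coeff-constP-other b {u} zeros≢u rewrite dec-false (≡-dec ℕ._≟_ zeros u) zeros≢u = refl

  -- (Σ_{N ∌ f} g(N ∪ {f}) x^N) · x_f = Σ_{M ∋ f} g(M) x^M, coefficientwise
  extend-divide : ∀ {k} (g : Subset k → Carrier) f d →
    maybe′ (extend (λ N → if lookup N f then 0# else g (N [ f ]≔ true))) 0# (d ∸ᵥ unit f)
      ≈ extend (λ M → if lookup M f then g M else 0#) d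
  extend-divide g f d with decode d in d≡
  ... | just M rewrite decode-just d d≡ with lookup M f in f∈M
  ...   | false rewrite ∸ᵥ-unit-absent M f f∈M = refl
  ...   | true  rewrite ∸ᵥ-unit-present M f f∈M | decode-monomial (M [ f ]≔ false)
                      | lookup∘update f M false | reinsert M f f∈M = refl
  extend-divide g f d | nothing with d ∸ᵥ unit f in d∸f
  ...   | nothing = refl
  ...   | just d′ with decode d′ in d′≡
  ...     | nothing = refl
  ...     | just N with lookup N f in f∈N
  ...       | true  = refl
  ...       | false with () ← ≡.trans (≡.sym d≡) (decode-multiple d d′ f d∸f d′≡ f∈N)

module Evaluation {c ℓ} (R : CommutativeRing c ℓ) (m : ℕ) where
  open CommutativeRing R
  open Sums R
  open Monomials
  open Poly R m using (Pol; sumP; eval; evalMon; pow)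
  open import Algebra.Properties.CommutativeSemigroup *-commutativeSemigroup using (interchange)

  eval-++ : ∀ (p q : Pol) x → eval (p ++ q) x ≈ eval p x + eval q x
  eval-++ []            q x = sym (+-identityˡ _)
  eval-++ ((b , v) ∷ p) q x = trans (+-congˡ (eval-++ p q x)) (sym (+-assoc _ _ _))

  eval-sumFin : ∀ {j} (g : Fin j → Pol) x →
                eval (sumP (map g (List.allFin j))) x ≈ sum (λ i → eval (g i) x)
  eval-sumFin g x = go g (λ i → i)
    where
    go : ∀ {j} {A : Set} (g : A → Pol) (h : Fin j → A) →
         eval (sumP (map g (List.tabulate h))) x ≈ sum (λ i → eval (g (h i)) x)
    go {zero}  g h = refl
    go {suc j} g h = trans (eval-++ (g (h fzero)) _ x) (+-congˡ (go g (h ∘ fsuc)))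

  evalMon-zeros : ∀ {k} x → evalMon {k = k} zeros x ≈ 1#
  evalMon-zeros {zero}  x = refl
  evalMon-zeros {suc k} x = trans (*-identityˡ _) (evalMon-zeros (x ∘ fsuc))

  evalMon-unit : ∀ {k} (e : Fin k) x → evalMon (unit e) x ≈ x e
  evalMon-unit {suc k} fzero x rewrite zeros-tabulate {k} =
    trans (*-cong (*-identityʳ _) (evalMon-zeros (x ∘ fsuc))) (*-identityʳ _)
  evalMon-unit (fsuc e) x = trans (*-identityˡ _) (evalMon-unit e (x ∘ fsuc))

  pow-+ : ∀ y i j → pow y (i ℕ.+ j) ≈ pow y i * pow y j
  pow-+ y zero    j = sym (*-identityˡ _)
  pow-+ y (suc i) j = trans (*-congˡ (pow-+ y i j)) (sym (*-assoc _ _ _))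

  evalMon-+ : ∀ {k} (u w : Vec ℕ k) x → evalMon (u +ᵥ w) x ≈ evalMon u x * evalMon w x
  evalMon-+ []      []      x = sym (*-identityˡ 1#)
  evalMon-+ (i ∷ u) (j ∷ w) x =
    trans (*-cong (pow-+ (x fzero) i j) (evalMon-+ u w (x ∘ fsuc))) (interchange _ _ _ _)

module Matchings {n : ℕ} (G : SimpleGraph n) where
  open Graph G

  src tgt : Fin m → Fin n
  src e = proj₁ (ends e)
  tgt e = proj₂ (ends e)

  src-incident : ∀ e → Incident (src e) e
  src-incident e = inj₁ ≡.refl

  tgt-incident : ∀ e → Incident (tgt e) e
  tgt-incident e = inj₂ ≡.refl

  incident-dec : ∀ v e → Dec (Incident v e)
  incident-dec v e = (src e ≟F v) ⊎-dec (tgt e ≟F v)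

  incident?-true : ∀ {v e} → Incident v e → incident? v e ≡ true
  incident?-true {v} {e} = dec-true (incident-dec v e)

  incident?-false : ∀ {v e} → ¬ Incident v e → incident? v e ≡ false
  incident?-false {v} {e} = dec-false (incident-dec v e)

  matching? : ∀ S → Dec (IsMatching S)
  matching? S = all? λ e → all? λ f →
    (e ∈? S) →-dec (f ∈? S) →-dec ¬? (e ≟F f) →-dec
      ¬? (any? λ v → incident-dec v e ×-dec incident-dec v f)

  ∈⇒lookup : ∀ (S : Subset m) {e} → e ∈ S → lookup S e ≡ true
  ∈⇒lookup S = []=⇒lookup

  lookup⇒∈ : ∀ (S : Subset m) {e} → lookup S e ≡ true → e ∈ S
  lookup⇒∈ S {e} = lookup⇒[]= e S

  Covered : Subset m → Fin n → Set
  Covered S v = ∃ λ f → lookup S f ≡ true × Incident v f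

  covered? : ∀ S v → Dec (Covered S v)
  covered? S v = any? λ f → (lookup S f ≟B true) ×-dec incident-dec v f

  matching-edge-unique : ∀ {M} → IsMatching M → ∀ {v e f} → lookup M e ≡ true → lookup M f ≡ true →
                         Incident v e → Incident v f → e ≡ f
  matching-edge-unique {M} M-match {v} {e} {f} e∈M f∈M v∈e v∈f with e ≟F f
  ... | yes e≡f = e≡f
  ... | no  e≢f = ⊥-elim (M-match e f (lookup⇒∈ M e∈M) (lookup⇒∈ M f∈M) e≢f (v , v∈e , v∈f))

  empty-matching : IsMatching (⊥ {n = m})
  empty-matching e f e∈⊥ _ _ _ = ∉⊥ e∈⊥

  matching-⊆ : ∀ {S T} → S ⊆ T → IsMatching T → IsMatching S
  matching-⊆ S⊆T T-match e f e∈S f∈S = T-match e f (S⊆T e∈S) (S⊆T f∈S)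

  ⊆-insert : ∀ (S : Subset m) e → S ⊆ S [ e ]≔ true
  ⊆-insert S e {f} f∈S with f ≟F e
  ... | yes ≡.refl = lookup⇒∈ (S [ e ]≔ true) (lookup∘update f S true)
  ... | no  f≢e    = lookup⇒∈ (S [ e ]≔ true) (≡.trans (lookup∘update′ f≢e S true) (∈⇒lookup S f∈S))

  insert-other : ∀ {M e f} → f ≢ e → f ∈ M [ e ]≔ true → lookup M f ≡ true
  insert-other {M} {e} f≢e f∈ =
    ≡.trans (≡.sym (lookup∘update′ f≢e M true)) (∈⇒lookup (M [ e ]≔ true) f∈)

  endpoint-free : ∀ {e v} M → ¬ Covered M (src e) → ¬ Covered M (tgt e) → Incident v e → ¬ Covered M v
  endpoint-free M src-free _ (inj₁ ≡.refl) = src-free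
  endpoint-free M _ tgt-free (inj₂ ≡.refl) = tgt-free

  insert-matching : ∀ M e → IsMatching M → ¬ Covered M (src e) → ¬ Covered M (tgt e) →
                    IsMatching (M [ e ]≔ true)
  insert-matching M e M-match src-free tgt-free g h g∈ h∈ g≢h (v , v∈g , v∈h)
    with g ≟F e | h ≟F e
  ... | yes ≡.refl | yes ≡.refl = g≢h ≡.refl
  ... | yes ≡.refl | no  h≢e    = endpoint-free M src-free tgt-free v∈g (h , insert-other h≢e h∈ , v∈h)
  ... | no  g≢e    | yes ≡.refl = endpoint-free M src-free tgt-free v∈h (g , insert-other g≢e g∈ , v∈g)
  ... | no  g≢e    | no  h≢e    =
    M-match g h (lookup⇒∈ M (insert-other g≢e g∈)) (lookup⇒∈ M (insert-other h≢e h∈))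
            g≢h (v , v∈g , v∈h)

  insert-non-matching : ∀ M e → lookup M e ≡ false → ∀ {v} → Incident v e → Covered M v →
                        ¬ IsMatching (M [ e ]≔ true)
  insert-non-matching M e e∉M v∈e (f , f∈M , v∈f) M′-match =
    M′-match e f (lookup⇒∈ (M [ e ]≔ true) (lookup∘update e M true)) (⊆-insert M e (lookup⇒∈ M f∈M))
             e≢f (_ , v∈e , v∈f)
    where
    e≢f : e ≢ f
    e≢f ≡.refl with () ← ≡.trans (≡.sym f∈M) e∉M

module FieldArithmetic {c ℓ} (F : Field c ℓ) where
  open Field F using (commutativeRing; 1≉0; inverse)
  open CommutativeRing commutativeRing
  open import Algebra.Properties.Ring ring using (-‿involutive; -0#≈0#)
  open import Algebra.Properties.Group +-group using (∙-cancelˡ)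
  open import Relation.Binary.Reasoning.Setoid setoid
  open IntegerCoefficients commutativeRing using (nat; nat-suc; natToRing≈nat)

  *-nonzero : ∀ {x y} → ¬ (x ≈ 0#) → ¬ (y ≈ 0#) → ¬ (x * y ≈ 0#)
  *-nonzero {x} {y} x≉0 y≉0 xy≈0 with inverse x x≉0
  ... | x⁻¹ , xx⁻¹≈1 = y≉0 (begin
    y               ≈⟨ *-identityˡ y ⟨
    1# * y          ≈⟨ *-congʳ (trans (sym xx⁻¹≈1) (*-comm x x⁻¹)) ⟩
    (x⁻¹ * x) * y   ≈⟨ *-assoc x⁻¹ x y ⟩
    x⁻¹ * (x * y)   ≈⟨ *-congˡ xy≈0 ⟩
    x⁻¹ * 0#        ≈⟨ zeroʳ x⁻¹ ⟩
    0#              ∎)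

  -‿nonzero : ∀ {x} → ¬ (x ≈ 0#) → ¬ (- x ≈ 0#)
  -‿nonzero {x} x≉0 -x≈0 = x≉0 (trans (sym (-‿involutive x)) (trans (-‿cong -x≈0) -0#≈0#))

  module CharacteristicZero (char0 : CharZero F) where

    nat-nonzero : ∀ j → ¬ (nat (suc j) ≈ 0#)
    nat-nonzero j = char0 j ∘ trans (natToRing≈nat (suc j))

    nat-injective : ∀ x y → nat x ≈ nat y → x ≡ y
    nat-injective zero    zero    _  = ≡.refl
    nat-injective zero    (suc y) eq = ⊥-elim (nat-nonzero y (sym eq))
    nat-injective (suc x) zero    eq = ⊥-elim (nat-nonzero x eq)
    nat-injective (suc x) (suc y) eq = ≡.cong suc (nat-injective x y
      (∙-cancelˡ 1# (nat x) (nat y) (trans (sym (nat-suc x)) (trans eq (nat-suc y)))))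

    -- the reciprocal 1 / (j · 1), taken to be 0 for j = 0
    reciprocal : ℕ → Carrier
    reciprocal zero    = 0#
    reciprocal (suc j) = proj₁ (inverse (nat (suc j)) (nat-nonzero j))

    reciprocal-inverse : ∀ j → nat (suc j) * reciprocal (suc j) ≈ 1#
    reciprocal-inverse j = proj₂ (inverse (nat (suc j)) (nat-nonzero j))

    reciprocal-nonzero : ∀ j → ¬ (reciprocal (suc j) ≈ 0#)
    reciprocal-nonzero j r≈0 =
      1≉0 (trans (sym (reciprocal-inverse j)) (trans (*-congˡ r≈0) (zeroʳ _)))

module Construction {c ℓ} (F : Field c ℓ) (char0 : CharZero F) {n : ℕ} (G : SimpleGraph n) where
  open Field F using (commutativeRing; 1≉0)
  open CommutativeRing commutativeRing
  open import Algebra.Properties.Ring ring using (-‿involutive; -0#≈0#; -‿+-comm; -‿distribʳ-*)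
  open import Relation.Binary.Reasoning.Setoid setoid
  open IntegerCoefficients commutativeRing
  open FieldArithmetic F
  open CharacteristicZero char0
  open Sums commutativeRing
  open Monomials
  open Coefficients commutativeRing
  open Matchings G
  open Matching F G
    using (m; loopless; Incident; incident?; Valid; valid?; IsMatching; MaxMatchingSize;
           Pol; coeff; HasDegree; DegreeAtMost;
           varP; zeroP; constP; oneP; _*P_; sumFin; vertexPoly; pairPoly; Infeasible; IsCertificate)

  -- the scalars a_k with a_0 n = 1 and a_{k+1} (n − 2k − 2) = (2k + 2) a_k
  a : ℕ → Carrier
  a zero    = reciprocal n
  a (suc k) = nat (suc k ℕ.+ suc k) * a k * reciprocal (n ∸ (suc k ℕ.+ suc k))

  ∸-positive : ∀ j i → i ℕ.< j → ∃ λ t → j ∸ i ≡ suc t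
  ∸-positive (suc j) zero    _             = j , ≡.refl
  ∸-positive (suc j) (suc i) (ℕ.s≤s i<j) = ∸-positive j i i<j

  a-zero : 0 ℕ.< n → nat n * a 0 ≈ 1#
  a-zero 0<n with ∸-positive n 0 0<n
  ... | t , ≡.refl = reciprocal-inverse t

  a-suc : ∀ k → suc k ℕ.+ suc k ℕ.< n →
          nat (n ∸ (suc k ℕ.+ suc k)) * a (suc k) ≈ nat (suc k ℕ.+ suc k) * a k
  a-suc k lt with n ∸ (suc k ℕ.+ suc k) | ∸-positive n (suc k ℕ.+ suc k) lt
  ... | _ | t , ≡.refl = begin
    nat (suc t) * (X * reciprocal (suc t))   ≈⟨ *-congˡ (*-comm X _) ⟩
    nat (suc t) * (reciprocal (suc t) * X)   ≈⟨ *-assoc _ _ _ ⟨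
    (nat (suc t) * reciprocal (suc t)) * X   ≈⟨ *-congʳ (reciprocal-inverse t) ⟩
    1# * X                                   ≈⟨ *-identityˡ X ⟩
    X                                        ∎
    where X = nat (suc k ℕ.+ suc k) * a k

  a-nonzero : ∀ k → k ℕ.+ k ℕ.< n → ¬ (a k ≈ 0#)
  a-nonzero zero    0<n with ∸-positive n 0 0<n
  ... | t , ≡.refl = reciprocal-nonzero t
  a-nonzero (suc k) lt with n ∸ (suc k ℕ.+ suc k) | ∸-positive n (suc k ℕ.+ suc k) lt
  ... | _ | t , ≡.refl =
    *-nonzero (*-nonzero (nat-nonzero (k ℕ.+ suc k)) (a-nonzero k k+k<n)) (reciprocal-nonzero t)
    where
    k+k<n : k ℕ.+ k ℕ.< n
    k+k<n = ℕP.<-trans (ℕP.+-mono-< (ℕP.n<1+n k) (ℕP.n<1+n k)) lt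

  if-vanishes : ∀ b {x} → x ≈ 0# → (if b then x else 0#) ≈ 0#
  if-vanishes true  x≈0 = x≈0
  if-vanishes false _   = refl

  sumOver : Subset m → (Fin m → Carrier) → Carrier
  sumOver S t = sum (λ g → if lookup S g then t g else 0#)

  sumOver-matched : ∀ {M} → IsMatching M → ∀ {v f} → lookup M f ≡ true → Incident v f →
                    (t : Fin m → Carrier) → (∀ g → ¬ Incident v g → t g ≈ 0#) → sumOver M t ≈ t f
  sumOver-matched {M} M-match {v} {f} f∈M v∈f t t≈0 = trans (sum-single f off-f) (reflexive on-f)
    where
    on-f : (if lookup M f then t f else 0#) ≡ t f
    on-f rewrite f∈M = ≡.refl
    off-f : ∀ g → g ≢ f → (if lookup M g then t g else 0#) ≈ 0#
    off-f g g≢f with lookup M g in g∈M | incident-dec v g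
    ... | false | _       = refl
    ... | true  | yes v∈g = ⊥-elim (g≢f (matching-edge-unique M-match g∈M f∈M v∈g v∈f))
    ... | true  | no  v∉g = t≈0 g v∉g

  sumOver-uncovered : ∀ {M v} → ¬ Covered M v → (t : Fin m → Carrier) →
                      (∀ g → ¬ Incident v g → t g ≈ 0#) → sumOver M t ≈ 0#
  sumOver-uncovered {M} {v} v-free t t≈0 = sum-zero off
    where
    off : ∀ g → (if lookup M g then t g else 0#) ≈ 0#
    off g with lookup M g in g∈M | incident-dec v g
    ... | false | _       = refl
    ... | true  | yes v∈g = ⊥-elim (v-free (g , g∈M , v∈g))
    ... | true  | no  v∉g = t≈0 g v∉g

  δ : Fin n → Fin n → Carrier
  δ v x = ind (does (x ≟F v))

  δ-same : ∀ v → δ v v ≈ 1#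
  δ-same v rewrite dec-true (v ≟F v) ≡.refl = refl

  δ-other : ∀ {v x} → x ≢ v → δ v x ≈ 0#
  δ-other {v} {x} x≢v rewrite dec-false (x ≟F v) x≢v = refl

  orientation : Fin n → Fin m → Carrier
  orientation v g = δ v (src g) - δ v (tgt g)

  orientation-off : ∀ {v g} → ¬ Incident v g → orientation v g ≈ 0#
  orientation-off v∉g = trans (+-cong (δ-other (v∉g ∘ inj₁)) (-‿cong (δ-other (v∉g ∘ inj₂))))
                              (trans (+-congˡ -0#≈0#) (+-identityʳ 0#))

  -- χ S v = [v is covered by S],  σ S v = the orientation of the S-edge at v
  χ : Subset m → Fin n → Carrier
  χ S v = sumOver S (λ g → ind (incident? v g))

  σ : Subset m → Fin n → Carrier
  σ S v = sumOver S (orientation v)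

  ind-incident-off : ∀ {v g} → ¬ Incident v g → ind (incident? v g) ≈ 0#
  ind-incident-off v∉g rewrite incident?-false v∉g = refl

  χ-covered : ∀ {M} → IsMatching M → ∀ {v f} → lookup M f ≡ true → Incident v f → χ M v ≈ 1#
  χ-covered {M} M-match f∈M v∈f =
    trans (sumOver-matched {M} M-match f∈M v∈f _ (λ _ → ind-incident-off))
          (reflexive (≡.cong ind (incident?-true v∈f)))

  χ-uncovered : ∀ {M v} → ¬ Covered M v → χ M v ≈ 0#
  χ-uncovered {M} v-free = sumOver-uncovered {M} v-free _ (λ _ → ind-incident-off)

  σ-covered : ∀ {M} → IsMatching M → ∀ {v f} → lookup M f ≡ true → Incident v f →
              σ M v ≈ orientation v f
  σ-covered {M} M-match f∈M v∈f = sumOver-matched {M} M-match f∈M v∈f _ (λ _ → orientation-off)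

  σ-uncovered : ∀ {M v} → ¬ Covered M v → σ M v ≈ 0#
  σ-uncovered {M} v-free = sumOver-uncovered {M} v-free _ (λ _ → orientation-off)

  1-χ-covered : ∀ {M} → IsMatching M → ∀ {v} → Covered M v → 1# - χ M v ≈ 0#
  1-χ-covered {M} M-match (f , f∈M , v∈f) =
    trans (+-congˡ (-‿cong (χ-covered {M} M-match f∈M v∈f))) (-‿inverseʳ 1#)

  1-χ-uncovered : ∀ {M v} → ¬ Covered M v → 1# - χ M v ≈ 1#
  1-χ-uncovered {M} v-free = trans (+-congˡ (trans (-‿cong (χ-uncovered {M} v-free)) -0#≈0#)) (+-identityʳ 1#)

  orientation-src : ∀ e → orientation (src e) e ≈ 1#
  orientation-src e = trans (+-cong (δ-same (src e)) (-‿cong (δ-other (loopless e ∘ ≡.sym))))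
                            (trans (+-congˡ -0#≈0#) (+-identityʳ 1#))

  orientation-tgt : ∀ e → orientation (tgt e) e ≈ - 1#
  orientation-tgt e = trans (+-cong (δ-other (loopless e)) (-‿cong (δ-same (tgt e)))) (+-identityˡ _)

  isMatching : Subset m → Bool
  isMatching S = does (matching? S)

  D : Fin n → Subset m → Carrier
  D v S = if isMatching S then - (a ∣ S ∣ * (1# - χ S v) + σ S v) else 0#

  D-matching : ∀ {S} v → IsMatching S → D v S ≈ - (a ∣ S ∣ * (1# - χ S v) + σ S v)
  D-matching {S} v S-match rewrite dec-true (matching? S) S-match = refl

  D-non-matching : ∀ {S} v → ¬ IsMatching S → D v S ≈ 0#
  D-non-matching {S} v ¬S-match rewrite dec-false (matching? S) ¬S-match = refl

  D-covered : ∀ {M} → IsMatching M → ∀ {v f} → lookup M f ≡ true → Incident v f →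
              D v M ≈ - orientation v f
  D-covered {M} M-match {v} {f} f∈M v∈f = begin
    D v M
      ≈⟨ D-matching v M-match ⟩
    - (a ∣ M ∣ * (1# - χ M v) + σ M v)
      ≈⟨ -‿cong (+-cong (*-congˡ (1-χ-covered M-match (f , f∈M , v∈f))) (σ-covered {M} M-match f∈M v∈f)) ⟩
    - (a ∣ M ∣ * 0# + orientation v f)
      ≈⟨ -‿cong (trans (+-congʳ (zeroʳ _)) (+-identityˡ _)) ⟩
    - orientation v f ∎

  D-uncovered : ∀ {M} → IsMatching M → ∀ {v} → ¬ Covered M v → D v M ≈ - a ∣ M ∣
  D-uncovered {M} M-match {v} v-free = begin
    D v M
      ≈⟨ D-matching v M-match ⟩
    - (a ∣ M ∣ * (1# - χ M v) + σ M v)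
      ≈⟨ -‿cong (+-cong (*-congˡ (1-χ-uncovered {M} v-free)) (σ-uncovered {M} v-free)) ⟩
    - (a ∣ M ∣ * 1# + 0#)
      ≈⟨ -‿cong (trans (+-identityʳ _) (*-identityʳ _)) ⟩
    - a ∣ M ∣ ∎

  opposite : Fin n → Fin m → Fin n
  opposite v e = if does (src e ≟F v) then tgt e else src e

  opposite-src : ∀ e → opposite (src e) e ≡ tgt e
  opposite-src e rewrite dec-true (src e ≟F src e) ≡.refl = ≡.refl

  opposite-tgt : ∀ e → opposite (tgt e) e ≡ src e
  opposite-tgt e rewrite dec-false (src e ≟F tgt e) (loopless e) = ≡.refl

  -- H v e (N ∪ {f}) is the coefficient of x^N in Θ^v_{ef}; with w the other
  -- endpoint of e it is chosen so that the terms at x^M x_e combine as in Z-absent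
  H : Fin n → Fin m → Subset m → Carrier
  H v e M = - (D v M + (1# - χ M w) * D w M)
    where w = opposite v e

  H-non-matching : ∀ {M} v e → ¬ IsMatching M → H v e M ≈ 0#
  H-non-matching v e ¬M-match = trans (-‿cong (trans (+-cong (D-non-matching v ¬M-match)
    (trans (*-congˡ (D-non-matching (opposite v e) ¬M-match)) (zeroʳ _))) (+-identityˡ 0#))) -0#≈0#

  T : Fin n → Fin m → Fin m → Subset m → Carrier
  T v e f N = if lookup N f then 0# else H v e (N [ f ]≔ true)

  Δ : Fin n → Pol
  Δ v = subsetPoly (D v)

  Θ : Fin n → Fin m → Fin m → Pol
  Θ v e f = subsetPoly (T v e f)

  -- Z e M is the coefficient of x^M x_e collected from the terms Δ_i x_e
  -- (i ∈ e) and Θ^i_{ef} x_e x_f of the certificate (see coeff-RHS);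
  -- Y i e M is the part coming from Θ^i_{ef}.

  Y : Fin n → Fin m → Subset m → Carrier
  Y i e M = sum (λ f → if valid? i e f then (if lookup M f then H i e M else 0#) else 0#)

  Z : Fin m → Subset m → Carrier
  Z e M = sum (λ i → if incident? i e then D i M else 0#) + sum (λ i → Y i e M)

  sum-endpoints : ∀ e (g : Fin n → Carrier) →
                  sum (λ i → if incident? i e then g i else 0#) ≈ g (src e) + g (tgt e)
  sum-endpoints e g =
    trans (sum-pair (src e) (tgt e) (loopless e) off) (+-cong (on (src-incident e)) (on (tgt-incident e)))
    where
    on : ∀ {i} → Incident i e → (if incident? i e then g i else 0#) ≈ g i
    on i∈e rewrite incident?-true i∈e = refl
    off : ∀ i → i ≢ src e → i ≢ tgt e → (if incident? i e then g i else 0#) ≈ 0#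
    off i i≢src i≢tgt rewrite incident?-false {i} {e} [ i≢src ∘ ≡.sym , i≢tgt ∘ ≡.sym ] = refl

  sum-Y : ∀ e M → sum (λ i → Y i e M) ≈ Y (src e) e M + Y (tgt e) e M
  sum-Y e M = trans (sum-cong-≋ only-endpoints) (sum-endpoints e (λ i → Y i e M))
    where
    only-endpoints : ∀ i → Y i e M ≈ (if incident? i e then Y i e M else 0#)
    only-endpoints i with incident? i e
    ... | true  = refl
    ... | false = sum-zero {m} (λ _ → refl)

  -- e ∉ M: the edges f ∈ M at i are exactly the f with (i, e, f) valid
  Y-absent : ∀ M {i e} → lookup M e ≡ false → Incident i e → Y i e M ≈ χ M i * H i e M
  Y-absent M {i} {e} e∉M i∈e =
    trans (sum-cong-≋ term) (sym (*-distribʳ-sum (H i e M) (λ f → if lookup M f then ind (incident? i f) else 0#)))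
    where
    term : ∀ f → (if valid? i e f then (if lookup M f then H i e M else 0#) else 0#)
               ≈ (if lookup M f then ind (incident? i f) else 0#) * H i e M
    term f with e ≟F f
    ... | yes ≡.refl rewrite incident?-true i∈e | e∉M = sym (zeroˡ _)
    ... | no  _      rewrite incident?-true i∈e with incident? i f | lookup M f
    ...   | true  | true  = sym (*-identityˡ _)
    ...   | true  | false = sym (zeroˡ _)
    ...   | false | true  = sym (zeroˡ _)
    ...   | false | false = sym (zeroˡ _)

  -- e ∈ M for a matching M: no other edge of M meets e
  Y-present : ∀ {M} → IsMatching M → ∀ {i e} → lookup M e ≡ true → Incident i e → Y i e M ≈ 0#
  Y-present {M} M-match {i} {e} e∈M i∈e = sum-zero term
    where
    term : ∀ f → (if valid? i e f then (if lookup M f then H i e M else 0#) else 0#) ≈ 0#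
    term f with e ≟F f
    ... | yes ≡.refl rewrite incident?-true i∈e = refl
    ... | no  e≢f    rewrite incident?-true i∈e with incident-dec i f
    ...   | no  i∉f rewrite incident?-false i∉f = refl
    ...   | yes i∈f rewrite incident?-true i∈f with lookup M f in f∈M
    ...     | true  = ⊥-elim (e≢f (matching-edge-unique M-match e∈M f∈M i∈e i∈f))
    ...     | false = refl

  Z-split : ∀ e M → Z e M ≈ (D (src e) M + D (tgt e) M) + (Y (src e) e M + Y (tgt e) e M)
  Z-split e M = +-cong (sum-endpoints e (λ i → D i M)) (sum-Y e M)

  Z-present : ∀ {M} → IsMatching M → ∀ e → lookup M e ≡ true → Z e M ≈ 0#
  Z-present {M} M-match e e∈M = begin
    Z e M
      ≈⟨ Z-split e M ⟩
    (D (src e) M + D (tgt e) M) + (Y (src e) e M + Y (tgt e) e M)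
      ≈⟨ +-cong (+-cong (D-covered M-match e∈M (src-incident e)) (D-covered M-match e∈M (tgt-incident e)))
                (+-cong (Y-present M-match e∈M (src-incident e)) (Y-present M-match e∈M (tgt-incident e))) ⟩
    (- orientation (src e) e + - orientation (tgt e) e) + (0# + 0#)
      ≈⟨ +-cong (+-cong (-‿cong (orientation-src e)) (-‿cong (orientation-tgt e))) (+-identityʳ 0#) ⟩
    (- 1# + - - 1#) + 0#
      ≈⟨ trans (+-identityʳ _) (-‿inverseʳ (- 1#)) ⟩
    0# ∎

  Z-non-matching : ∀ {M} e → ¬ IsMatching M → Z e M ≈ 0#
  Z-non-matching {M} e ¬M-match = trans
    (+-cong (sum-zero λ i → if-vanishes (incident? i e) (D-non-matching i ¬M-match))
            (sum-zero λ i → sum-zero λ f →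
              if-vanishes (valid? i e f) (if-vanishes (lookup M f) (H-non-matching i e ¬M-match))))
    (+-identityˡ 0#)

  Z-absent : ∀ M e → lookup M e ≡ false →
             Z e M ≈ (1# - χ M (src e)) * (1# - χ M (tgt e)) * (D (src e) M + D (tgt e) M)
  Z-absent M e e∉M = begin
    Z e M
      ≈⟨ Z-split e M ⟩
    (Dp + Dq) + (Y p e M + Y q e M)
      ≈⟨ +-congˡ (+-cong (Y-absent M e∉M (src-incident e)) (Y-absent M e∉M (tgt-incident e))) ⟩
    (Dp + Dq) + (χ M p * H p e M + χ M q * H q e M)
      ≈⟨ reflexive (≡.cong₂ (λ w w′ → (Dp + Dq) + (χ M p * H′ p w + χ M q * H′ q w′))
                            (opposite-src e) (opposite-tgt e)) ⟩
    (Dp + Dq) + (χ M p * - (Dp + (1# - χ M q) * Dq) + χ M q * - (Dq + (1# - χ M p) * Dp))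
      ≈⟨ factorise (χ M p) (χ M q) Dp Dq ⟩
    (1# - χ M p) * (1# - χ M q) * (Dp + Dq) ∎
    where
    p = src e
    q = tgt e
    Dp = D p M
    Dq = D q M
    H′ : Fin n → Fin n → Carrier
    H′ v w = - (D v M + (1# - χ M w) * D w M)
    factorise : ∀ χp χq dp dq →
      (dp + dq) + (χp * - (dp + (1# - χq) * dq) + χq * - (dq + (1# - χp) * dp))
        ≈ (1# - χp) * (1# - χq) * (dp + dq)
    factorise = solve 4 (λ χp χq dp dq →
      (dp :+ dq) :+ (χp :* (:- (dp :+ (con (ℤ.+ 1) :- χq) :* dq)) :+ χq :* (:- (dq :+ (con (ℤ.+ 1) :- χp) :* dp)))
        := (con (ℤ.+ 1) :- χp) :* (con (ℤ.+ 1) :- χq) :* (dp :+ dq)) refl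

  Z-insert : ∀ M e → lookup M e ≡ false →
             Z e M ≈ (if isMatching (M [ e ]≔ true) then - (a ∣ M ∣ + a ∣ M ∣) else 0#)
  Z-insert M e e∉M with matching? M
  ... | no ¬M-match
    rewrite dec-false (matching? (M [ e ]≔ true)) (¬M-match ∘ matching-⊆ (⊆-insert M e)) =
    Z-non-matching e ¬M-match
  ... | yes M-match with covered? M (src e) | covered? M (tgt e)
  ...   | yes src-covered | _
    rewrite dec-false (matching? (M [ e ]≔ true)) (insert-non-matching M e e∉M (src-incident e) src-covered) =
    trans (Z-absent M e e∉M)
          (trans (*-congʳ (trans (*-congʳ (1-χ-covered M-match src-covered)) (zeroˡ _))) (zeroˡ _))
  ...   | no _ | yes tgt-covered
    rewrite dec-false (matching? (M [ e ]≔ true)) (insert-non-matching M e e∉M (tgt-incident e) tgt-covered) =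
    trans (Z-absent M e e∉M)
          (trans (*-congʳ (trans (*-congˡ (1-χ-covered M-match tgt-covered)) (zeroʳ _))) (zeroˡ _))
  ...   | no src-free | no tgt-free
    rewrite dec-true (matching? (M [ e ]≔ true)) (insert-matching M e M-match src-free tgt-free) = begin
    Z e M
      ≈⟨ Z-absent M e e∉M ⟩
    (1# - χ M (src e)) * (1# - χ M (tgt e)) * (D (src e) M + D (tgt e) M)
      ≈⟨ *-cong (*-cong (1-χ-uncovered {M} src-free) (1-χ-uncovered {M} tgt-free))
                (+-cong (D-uncovered M-match src-free) (D-uncovered M-match tgt-free)) ⟩
    1# * 1# * (- a ∣ M ∣ + - a ∣ M ∣)
      ≈⟨ trans (*-congʳ (*-identityˡ 1#)) (trans (*-identityˡ _) (-‿+-comm _ _)) ⟩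
    - (a ∣ M ∣ + a ∣ M ∣) ∎

  -- Σ_v χ S v = 2|S|: every edge has two endpoints
  sum-χ : ∀ S → sum (χ S) ≈ nat ∣ S ∣ + nat ∣ S ∣
  sum-χ S = begin
    sum (λ v → sum (λ g → if lookup S g then ind (incident? v g) else 0#))
      ≈⟨ ∑-comm (λ v g → if lookup S g then ind (incident? v g) else 0#) ⟩
    sum (λ g → sum (λ v → if lookup S g then ind (incident? v g) else 0#))
      ≈⟨ sum-cong-≋ two-endpoints ⟩
    sum (λ g → ind (lookup S g) + ind (lookup S g))
      ≈⟨ ∑-distrib-+ (λ g → ind (lookup S g)) (λ g → ind (lookup S g)) ⟩
    sum (λ g → ind (lookup S g)) + sum (λ g → ind (lookup S g))
      ≈⟨ +-cong (sum-indicator S) (sum-indicator S) ⟩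
    nat ∣ S ∣ + nat ∣ S ∣ ∎
    where
    two-endpoints : ∀ g → sum (λ v → if lookup S g then ind (incident? v g) else 0#)
                          ≈ ind (lookup S g) + ind (lookup S g)
    two-endpoints g with lookup S g
    ... | true  = sum-endpoints g (λ _ → 1#)
    ... | false = trans (sum-zero {n} (λ _ → refl)) (sym (+-identityʳ 0#))

  sum-1-χ : ∀ S → sum (λ v → 1# - χ S v) ≈ nat n - (nat ∣ S ∣ + nat ∣ S ∣)
  sum-1-χ S = trans (∑-distrib-+ (λ _ → 1#) (λ v → - χ S v))
                    (+-cong (sum-ones n) (trans (sum-neg (χ S)) (-‿cong (sum-χ S))))

  -- Σ_v σ S v = 0: every edge has one source and one target
  sum-σ : ∀ S → sum (σ S) ≈ 0#
  sum-σ S = trans (∑-comm (λ v g → if lookup S g then orientation v g else 0#)) (sum-zero cancels)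
    where
    sum-δ : ∀ x → sum (λ v → δ v x) ≈ 1#
    sum-δ x = trans (sum-single x (λ v v≢x → δ-other (v≢x ∘ ≡.sym))) (δ-same x)
    cancels : ∀ g → sum (λ v → if lookup S g then orientation v g else 0#) ≈ 0#
    cancels g with lookup S g
    ... | false = sum-zero {n} (λ _ → refl)
    ... | true  = begin
      sum (λ v → δ v (src g) - δ v (tgt g))           ≈⟨ ∑-distrib-+ (λ v → δ v (src g)) (λ v → - δ v (tgt g)) ⟩
      sum (λ v → δ v (src g)) + sum (λ v → - δ v (tgt g))
                                                      ≈⟨ +-congˡ (sum-neg (λ v → δ v (tgt g))) ⟩
      sum (λ v → δ v (src g)) - sum (λ v → δ v (tgt g))
                                                      ≈⟨ +-cong (sum-δ (src g)) (-‿cong (sum-δ (tgt g))) ⟩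
      1# - 1#                                         ≈⟨ -‿inverseʳ 1# ⟩
      0#                                              ∎

  sum-D : ∀ {S} → IsMatching S → sum (λ v → D v S) ≈ - (a ∣ S ∣ * (nat n - (nat ∣ S ∣ + nat ∣ S ∣)))
  sum-D {S} S-match = begin
    sum (λ v → D v S)
      ≈⟨ sum-cong-≋ (λ v → D-matching v S-match) ⟩
    sum (λ v → - (a k * (1# - χ S v) + σ S v))
      ≈⟨ sum-neg (λ v → a k * (1# - χ S v) + σ S v) ⟩
    - sum (λ v → a k * (1# - χ S v) + σ S v)
      ≈⟨ -‿cong (∑-distrib-+ (λ v → a k * (1# - χ S v)) (σ S)) ⟩
    - (sum (λ v → a k * (1# - χ S v)) + sum (σ S))
      ≈⟨ -‿cong (+-cong (sym (*-distribˡ-sum (a k) (λ v → 1# - χ S v))) (sum-σ S)) ⟩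
    - (a k * sum (λ v → 1# - χ S v) + 0#)
      ≈⟨ -‿cong (trans (+-identityʳ _) (*-congˡ (sum-1-χ S))) ⟩
    - (a k * (nat n - (nat k + nat k))) ∎
    where k = ∣ S ∣

  uncovered : Subset m → Subset n
  uncovered S = tabulate (λ v → not (does (covered? S v)))

  ind-uncovered : ∀ {S} → IsMatching S → ∀ v → ind (lookup (uncovered S) v) ≈ 1# - χ S v
  ind-uncovered {S} S-match v rewrite lookup∘tabulate (λ v → not (does (covered? S v))) v
    with covered? S v
  ... | yes v-covered = sym (1-χ-covered S-match v-covered)
  ... | no  v-free    = sym (1-χ-uncovered {S} v-free)

  -- a matching S covers 2|S| vertices; proved in F, using characteristic zero
  count-vertices : ∀ {S} → IsMatching S → ∣ uncovered S ∣ ℕ.+ (∣ S ∣ ℕ.+ ∣ S ∣) ≡ n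
  count-vertices {S} S-match = nat-injective _ _ (begin
    nat (u ℕ.+ (k ℕ.+ k))                ≈⟨ trans (nat-+ u (k ℕ.+ k)) (+-congˡ (nat-+ k k)) ⟩
    nat u + (nat k + nat k)              ≈⟨ +-congʳ (sym (sum-indicator (uncovered S))) ⟩
    sum (λ v → ind (lookup (uncovered S) v)) + (nat k + nat k)
                                         ≈⟨ +-congʳ (trans (sum-cong-≋ (ind-uncovered S-match)) (sum-1-χ S)) ⟩
    (nat n - (nat k + nat k)) + (nat k + nat k)
                                         ≈⟨ minus-plus (nat n) (nat k + nat k) ⟩
    nat n                                ∎)
    where
    u = ∣ uncovered S ∣
    k = ∣ S ∣
    minus-plus : ∀ x y → (x - y) + y ≈ x
    minus-plus = solve 2 (λ x y → (x :- y) :+ y := x) refl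

  module PerfectMatching (S : Subset m) (S-match : IsMatching S) (S-perfect : ∀ v → Covered S v) where
    open Poly commutativeRing m using (eval; evalMon)
    open Evaluation commutativeRing m

    x : Fin m → Carrier
    x e = ind (lookup S e)

    eval-var : ∀ b e → eval (if b then varP e else zeroP) x ≈ (if b then x e else 0#)
    eval-var true  e = trans (+-identityʳ _) (trans (*-identityˡ _) (evalMon-unit e x))
    eval-var false e = refl

    vertex-equation : ∀ i → eval (vertexPoly i) x ≈ 0#
    vertex-equation i with S-perfect i
    ... | f , f∈S , i∈f = begin
      eval (vertexPoly i) x
        ≈⟨ eval-++ (sumFin (λ e → if incident? i e then varP e else zeroP)) (constP (- 1#)) x ⟩
      eval (sumFin (λ e → if incident? i e then varP e else zeroP)) x + eval (constP (- 1#)) x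
        ≈⟨ +-cong (trans (eval-sumFin (λ e → if incident? i e then varP e else zeroP) x)
                         (sum-cong-≋ (λ e → eval-var (incident? i e) e)))
                  (trans (+-identityʳ _) (trans (*-congˡ (evalMon-zeros x)) (*-identityʳ _))) ⟩
      sum (λ e → if incident? i e then x e else 0#) - 1#
        ≈⟨ +-congʳ (trans (sum-cong-≋ swap-tests) (χ-covered S-match f∈S i∈f)) ⟩
      1# - 1#
        ≈⟨ -‿inverseʳ 1# ⟩
      0# ∎
      where
      swap-tests : ∀ e → (if incident? i e then x e else 0#) ≈ (if lookup S e then ind (incident? i e) else 0#)
      swap-tests e with incident? i e | lookup S e
      ... | true  | true  = refl
      ... | true  | false = refl
      ... | false | true  = refl
      ... | false | false = refl

    pair-equation : ∀ i e f → Valid i e f → eval (pairPoly e f) x ≈ 0#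
    pair-equation i e f (i∈e , i∈f , e≢f) = begin
      eval (pairPoly e f) x                         ≈⟨ +-identityʳ _ ⟩
      (1# * 1#) * evalMon (unit e +ᵥ unit f) x      ≈⟨ trans (*-congʳ (*-identityˡ 1#)) (*-identityˡ _) ⟩
      evalMon (unit e +ᵥ unit f) x                  ≈⟨ evalMon-+ (unit e) (unit f) x ⟩
      evalMon (unit e) x * evalMon (unit f) x       ≈⟨ *-cong (evalMon-unit e x) (evalMon-unit f x) ⟩
      x e * x f                                     ≈⟨ not-both ⟩
      0#                                            ∎
      where
      not-both : x e * x f ≈ 0#
      not-both with lookup S e in e∈S | lookup S f in f∈S
      ... | true  | true  = ⊥-elim (e≢f (matching-edge-unique S-match e∈S f∈S i∈e i∈f))
      ... | true  | false = zeroʳ _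
      ... | false | _     = zeroˡ _

  uncovered-vertex : Infeasible → ∀ S → IsMatching S → ∃ λ v → ¬ Covered S v
  uncovered-vertex infeasible S S-match with all? (covered? S)
  ... | yes S-perfect = ⊥-elim (infeasible (x , vertex-equation , pair-equation))
    where open PerfectMatching S S-match S-perfect
  ... | no ¬S-perfect = ¬∀⟶∃¬ n (Covered S) (covered? S) ¬S-perfect

  double-size< : Infeasible → ∀ {S} → IsMatching S → ∣ S ∣ ℕ.+ ∣ S ∣ ℕ.< n
  double-size< infeasible {S} S-match = ≡.subst (∣ S ∣ ℕ.+ ∣ S ∣ ℕ.<_) (count-vertices S-match)
    (ℕP.+-monoˡ-≤ (∣ S ∣ ℕ.+ ∣ S ∣) (ℕP.≤-trans (ℕ.s≤s ℕ.z≤n) (x∈p⇒∣p-x∣<∣p∣ v-uncovered)))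
    where
    v = proj₁ (uncovered-vertex infeasible S S-match)
    v-uncovered : v ∈ uncovered S
    v-uncovered = lookup⇒[]= v (uncovered S) (≡.trans (lookup∘tabulate _ v)
      (≡.cong not (dec-false (covered? S v) (proj₂ (uncovered-vertex infeasible S S-match)))))

  D-nonzero : Infeasible → ∀ {M} → IsMatching M → ∀ v → ¬ (D v M ≈ 0#)
  D-nonzero infeasible {M} M-match v with covered? M v
  ... | no v-free = -‿nonzero (a-nonzero ∣ M ∣ (double-size< infeasible M-match))
                  ∘ trans (sym (D-uncovered M-match v-free))
  ... | yes (f , f∈M , inj₁ ≡.refl) = -‿nonzero 1≉0
        ∘ trans (sym (trans (D-covered M-match f∈M (src-incident f)) (-‿cong (orientation-src f))))
  ... | yes (f , f∈M , inj₂ ≡.refl) = -‿nonzero (-‿nonzero 1≉0)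
        ∘ trans (sym (trans (D-covered M-match f∈M (tgt-incident f)) (-‿cong (orientation-tgt f))))

  K : Fin n → Fin m → Fin m → Subset m → Carrier
  K i e f M = if lookup M f then H i e M else 0#

  coeff-Δ-vertex : ∀ i u → coeff (Δ i *P vertexPoly i) u ≈
    sum (λ e → if incident? i e then maybe′ (extend (D i)) 0# (u ∸ᵥ unit e) else 0#) - extend (D i) u
  coeff-Δ-vertex i u = trans (coeff-*-++ (Δ i) (sumFin edgeVar) (constP (- 1#)) u)
    (+-cong (trans (coeff-*-sumFin (Δ i) edgeVar u) (sum-cong-≋ by-edge)) by-constant)
    where
    edgeVar : Fin m → Pol
    edgeVar e = if incident? i e then varP e else zeroP
    by-edge : ∀ e → coeff (Δ i *P edgeVar e) u ≈
                    (if incident? i e then maybe′ (extend (D i)) 0# (u ∸ᵥ unit e) else 0#)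
    by-edge e with incident? i e
    ... | true  = trans (coeff-*-term (Δ i) 1# (unit e) u)
                        (maybe′-cong (λ d → trans (*-identityʳ _) (coeff-subsetPoly (D i) d)) (u ∸ᵥ unit e))
    ... | false = coeff-*-[] (Δ i) u
    by-constant : coeff (Δ i *P constP (- 1#)) u ≈ - extend (D i) u
    by-constant = begin
      coeff (Δ i *P constP (- 1#)) u                       ≈⟨ coeff-*-term (Δ i) (- 1#) zeros u ⟩
      maybe′ (λ d → coeff (Δ i) d * - 1#) 0# (u ∸ᵥ zeros)  ≡⟨ ≡.cong (maybe′ _ 0#) (∸ᵥ-zeros u) ⟩
      coeff (Δ i) u * - 1#                                 ≈⟨ -‿distribʳ-* (coeff (Δ i) u) 1# ⟨
      - (coeff (Δ i) u * 1#)                               ≈⟨ -‿cong (*-identityʳ _) ⟩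
      - coeff (Δ i) u                                      ≈⟨ -‿cong (coeff-subsetPoly (D i) u) ⟩
      - extend (D i) u                                     ∎

  coeff-Θ-pair : ∀ i e f u → coeff (Θ i e f *P pairPoly e f) u ≈ maybe′ (extend (K i e f)) 0# (u ∸ᵥ unit e)
  coeff-Θ-pair i e f u = begin
    coeff (Θ i e f *P pairPoly e f) u
      ≈⟨ coeff-*-term (Θ i e f) (1# * 1#) (unit e +ᵥ unit f) u ⟩
    maybe′ g 0# (u ∸ᵥ (unit e +ᵥ unit f))
      ≡⟨ ≡.cong (maybe′ g 0#) (∸ᵥ-+ u (unit e) (unit f)) ⟩
    maybe′ g 0# (u ∸ᵥ unit e Maybe.>>= _∸ᵥ unit f)
      ≡⟨ maybe′-bind (u ∸ᵥ unit e) ⟩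
    maybe′ (λ d → maybe′ g 0# (d ∸ᵥ unit f)) 0# (u ∸ᵥ unit e)
      ≈⟨ maybe′-cong (λ d → trans (maybe′-cong coeff-Θ (d ∸ᵥ unit f)) (extend-divide (H i e) f d))
                     (u ∸ᵥ unit e) ⟩
    maybe′ (extend (K i e f)) 0# (u ∸ᵥ unit e) ∎
    where
    g : Vec ℕ m → Carrier
    g d = coeff (Θ i e f) d * (1# * 1#)
    coeff-Θ : ∀ d → g d ≈ extend (T i e f) d
    coeff-Θ d = trans (*-congˡ (*-identityˡ 1#)) (trans (*-identityʳ _) (coeff-subsetPoly (T i e f) d))
    maybe′-bind : ∀ md → maybe′ g 0# (md >>= _∸ᵥ unit f) ≡ maybe′ (λ d → maybe′ g 0# (d ∸ᵥ unit f)) 0# md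
    maybe′-bind (just _) = ≡.refl
    maybe′-bind nothing  = ≡.refl

  nothing-collected : ∀ e →
      sum (λ i → if incident? i e then 0# else 0#)
    + sum (λ i → sum (λ f → if valid? i e f then 0# else 0#)) ≈ 0#
  nothing-collected e = trans (+-cong (sum-zero λ i → if-vanishes (incident? i e) refl)
                                      (sum-zero λ i → sum-zero λ f → if-vanishes (valid? i e f) refl))
                              (+-identityˡ 0#)

  collect-edge : ∀ e md →
      sum (λ i → if incident? i e then maybe′ (extend (D i)) 0# md else 0#)
    + sum (λ i → sum (λ f → if valid? i e f then maybe′ (extend (K i e f)) 0# md else 0#))
    ≈ maybe′ (extend (Z e)) 0# md
  collect-edge e (just d) = collect (decode d)
    where
    collect : ∀ mt → sum (λ i → if incident? i e then maybe′ (D i) 0# mt else 0#)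
                   + sum (λ i → sum (λ f → if valid? i e f then maybe′ (K i e f) 0# mt else 0#))
                   ≈ maybe′ (Z e) 0# mt
    collect (just M) = refl
    collect nothing  = nothing-collected e
  collect-edge e nothing = nothing-collected e

  RHS : Pol
  RHS = sumFin (λ i → Δ i *P vertexPoly i)
     ++ sumFin (λ i → sumFin (λ e → sumFin (λ f → if valid? i e f then Θ i e f *P pairPoly e f else zeroP)))

  coeff-RHS : ∀ u → coeff RHS u ≈
    sum (λ e → maybe′ (extend (Z e)) 0# (u ∸ᵥ unit e)) - sum (λ i → extend (D i) u)
  coeff-RHS u = begin
    coeff RHS u
      ≈⟨ coeff-++ (sumFin (λ i → Δ i *P vertexPoly i)) _ u ⟩
    coeff (sumFin (λ i → Δ i *P vertexPoly i)) u + coeff (sumFin (λ i → sumFin (λ e → sumFin (pairTerm i e)))) u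
      ≈⟨ +-cong (trans (coeff-sumFin (λ i → Δ i *P vertexPoly i) u) (sum-cong-≋ (λ i → coeff-Δ-vertex i u)))
                (trans (coeff-sumFin (λ i → sumFin (λ e → sumFin (pairTerm i e))) u) (sum-cong-≋ λ i →
                  trans (coeff-sumFin (λ e → sumFin (pairTerm i e)) u) (sum-cong-≋ λ e →
                  trans (coeff-sumFin (pairTerm i e) u) (sum-cong-≋ λ f → coeff-pairTerm i e f)))) ⟩
    sum (λ i → sum (A i) - B i) + sum (λ i → sum (λ e → sum (C i e)))
      ≈⟨ +-cong (trans (∑-distrib-+ (λ i → sum (A i)) (λ i → - B i)) (+-cong (∑-comm A) (sum-neg B)))
                (∑-comm (λ i e → sum (C i e))) ⟩
    (sum (λ e → sum (λ i → A i e)) - sum B) + sum (λ e → sum (λ i → sum (C i e)))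
      ≈⟨ rearrange _ _ _ ⟩
    (sum (λ e → sum (λ i → A i e)) + sum (λ e → sum (λ i → sum (C i e)))) - sum B
      ≈⟨ +-congʳ (sym (∑-distrib-+ (λ e → sum (λ i → A i e)) (λ e → sum (λ i → sum (C i e))))) ⟩
    sum (λ e → sum (λ i → A i e) + sum (λ i → sum (C i e))) - sum B
      ≈⟨ +-congʳ (sum-cong-≋ (λ e → collect-edge e (u ∸ᵥ unit e))) ⟩
    sum (λ e → maybe′ (extend (Z e)) 0# (u ∸ᵥ unit e)) - sum B ∎
    where
    pairTerm : Fin n → Fin m → Fin m → Pol
    pairTerm i e f = if valid? i e f then Θ i e f *P pairPoly e f else zeroP
    A : Fin n → Fin m → Carrier
    A i e = if incident? i e then maybe′ (extend (D i)) 0# (u ∸ᵥ unit e) else 0#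
    B : Fin n → Carrier
    B i = extend (D i) u
    C : Fin n → Fin m → Fin m → Carrier
    C i e f = if valid? i e f then maybe′ (extend (K i e f)) 0# (u ∸ᵥ unit e) else 0#
    coeff-pairTerm : ∀ i e f → coeff (pairTerm i e f) u ≈ C i e f
    coeff-pairTerm i e f with valid? i e f
    ... | true  = coeff-Θ-pair i e f u
    ... | false = refl
    rearrange : ∀ x y z → (x - y) + z ≈ (x + z) - y
    rearrange = solve 3 (λ x y z → (x :- y) :+ z := (x :+ z) :- y) refl

  -- the common value of Z e (S ∖ {e}) for e ∈ S
  W : Subset m → Carrier
  W S = if isMatching S then - (a (ℕ.pred ∣ S ∣) + a (ℕ.pred ∣ S ∣)) else 0#

  edge-term-monomial : ∀ S e → maybe′ (extend (Z e)) 0# (monomial S ∸ᵥ unit e) ≈ ind (lookup S e) * W S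
  edge-term-monomial S e with lookup S e in e∈S
  ... | false rewrite ∸ᵥ-unit-absent S e e∈S = sym (zeroˡ _)
  ... | true  rewrite ∸ᵥ-unit-present S e e∈S | decode-monomial (S [ e ]≔ false) =
    trans (Z-insert (S [ e ]≔ false) e (lookup∘update e S false)) (trans (reflexive value) (sym (*-identityˡ _)))
    where
    size : ℕ.pred ∣ S ∣ ≡ ∣ S [ e ]≔ false ∣
    size = ≡.cong ℕ.pred (≡.trans (≡.cong ∣_∣ (≡.sym (reinsert S e e∈S)))
                                  (∣insert∣ (S [ e ]≔ false) e (lookup∘update e S false)))
    value : (if isMatching (S [ e ]≔ false [ e ]≔ true)
             then - (a ∣ S [ e ]≔ false ∣ + a ∣ S [ e ]≔ false ∣) else 0#) ≡ W S
    value rewrite reinsert S e e∈S | size = ≡.refl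

  sum-edge-terms-monomial : ∀ S →
    sum (λ e → maybe′ (extend (Z e)) 0# (monomial S ∸ᵥ unit e)) ≈ nat ∣ S ∣ * W S
  sum-edge-terms-monomial S = trans (sum-cong-≋ (edge-term-monomial S))
    (trans (sym (*-distribʳ-sum (W S) (λ e → ind (lookup S e)))) (*-congʳ (sum-indicator S)))

  edge-term-non-square-free : ∀ {u} → decode u ≡ nothing →
                              ∀ e → maybe′ (extend (Z e)) 0# (u ∸ᵥ unit e) ≈ 0#
  edge-term-non-square-free {u} u≡ e with u ∸ᵥ unit e in u∸e
  ... | nothing = refl
  ... | just d with decode d in d≡
  ...   | nothing = refl
  ...   | just M with lookup M e in e∈M
  ...     | false with () ← ≡.trans (≡.sym u≡) (decode-multiple u d e u∸e d≡ e∈M)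
  ...     | true with matching? M
  ...       | yes M-match = Z-present M-match e e∈M
  ...       | no ¬M-match = Z-non-matching e ¬M-match

  -- the recursion for a_k makes the coefficients of non-empty matchings cancel
  balance-empty : 0 ℕ.< n → nat 0 * - (a 0 + a 0) + a 0 * (nat n - (nat 0 + nat 0)) ≈ 1#
  balance-empty 0<n = begin
    nat 0 * - (a 0 + a 0) + a 0 * (nat n - (nat 0 + nat 0))  ≈⟨ +-cong (zeroˡ _) (*-congˡ n-0≈n) ⟩
    0# + a 0 * nat n                                         ≈⟨ trans (+-identityˡ _) (*-comm _ _) ⟩
    nat n * a 0                                              ≈⟨ a-zero 0<n ⟩
    1#                                                       ∎
    where
    n-0≈n : nat n - (0# + 0#) ≈ nat n
    n-0≈n = trans (+-congˡ (trans (-‿cong (+-identityʳ 0#)) -0#≈0#)) (+-identityʳ _)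

  balance-suc : ∀ k → suc k ℕ.+ suc k ℕ.< n →
                nat (suc k) * - (a k + a k) + a (suc k) * (nat n - (nat (suc k) + nat (suc k))) ≈ 0#
  balance-suc k lt = begin
    nat (suc k) * - (a k + a k) + a (suc k) * (nat n - (nat (suc k) + nat (suc k)))
      ≈⟨ +-congˡ (trans (*-congˡ remaining) (*-comm _ _)) ⟩
    nat (suc k) * - (a k + a k) + nat (n ∸ j) * a (suc k)
      ≈⟨ +-congˡ (trans (a-suc k lt) (*-congʳ (nat-+ (suc k) (suc k)))) ⟩
    nat (suc k) * - (a k + a k) + (nat (suc k) + nat (suc k)) * a k
      ≈⟨ cancel (nat (suc k)) (a k) ⟩
    0# ∎
    where
    j = suc k ℕ.+ suc k
    remaining : nat n - (nat (suc k) + nat (suc k)) ≈ nat (n ∸ j)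
    remaining = begin
      nat n - (nat (suc k) + nat (suc k))   ≈⟨ +-cong (reflexive (≡.cong nat (≡.sym (ℕP.m∸n+n≡m (ℕP.<⇒≤ lt)))))
                                                      (-‿cong (sym (nat-+ (suc k) (suc k)))) ⟩
      nat (n ∸ j ℕ.+ j) - nat j             ≈⟨ +-congʳ (nat-+ (n ∸ j) j) ⟩
      (nat (n ∸ j) + nat j) - nat j         ≈⟨ plus-minus (nat (n ∸ j)) (nat j) ⟩
      nat (n ∸ j)                           ∎
      where
      plus-minus : ∀ x y → (x + y) - y ≈ x
      plus-minus = solve 2 (λ x y → (x :+ y) :- y := x) refl
    cancel : ∀ x y → x * - (y + y) + (x + x) * y ≈ 0#
    cancel = solve 2 (λ x y → x :* (:- (y :+ y)) :+ (x :+ x) :* y := con (ℤ.+ 0)) refl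

  W-matching : ∀ {S} → IsMatching S → W S ≈ - (a (ℕ.pred ∣ S ∣) + a (ℕ.pred ∣ S ∣))
  W-matching {S} S-match rewrite dec-true (matching? S) S-match = refl

  W-non-matching : ∀ {S} → ¬ IsMatching S → W S ≈ 0#
  W-non-matching {S} ¬S-match rewrite dec-false (matching? S) ¬S-match = refl

  coeff-one-nonempty : ∀ S → ∣ S ∣ ≢ 0 → coeff oneP (monomial S) ≈ 0#
  coeff-one-nonempty S S≢∅ = coeff-constP-other 1# λ eq →
    S≢∅ (≡.trans (≡.cong ∣_∣ (monomial-zeros S (≡.sym eq))) (∣⊥∣≡0 m))

  balance-matching : Infeasible → ∀ {S} → IsMatching S →
                     nat ∣ S ∣ * W S - sum (λ v → D v S) ≈ coeff oneP (monomial S)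
  balance-matching infeasible {S} S-match = trans
    (+-cong (*-congˡ (W-matching S-match)) (trans (-‿cong (sum-D S-match)) (-‿involutive _)))
    (by-size ∣ S ∣ ≡.refl)
    where
    by-size : ∀ k → ∣ S ∣ ≡ k →
              nat k * - (a (ℕ.pred k) + a (ℕ.pred k)) + a k * (nat n - (nat k + nat k)) ≈ coeff oneP (monomial S)
    by-size zero    size = begin
      _  ≈⟨ balance-empty (≡.subst (λ k → k ℕ.+ k ℕ.< n) size (double-size< infeasible S-match)) ⟩
      1# ≈⟨ coeff-constP-zeros {m} 1# ⟨
      coeff oneP zeros ≡⟨ ≡.cong (coeff oneP) (monomial-empty S size) ⟨
      coeff oneP (monomial S) ∎
    by-size (suc k) size =
      trans (balance-suc k (≡.subst (λ k → k ℕ.+ k ℕ.< n) size (double-size< infeasible S-match)))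
            (sym (coeff-one-nonempty S λ S≡∅ → ℕP.1+n≢0 (≡.trans (≡.sym size) S≡∅)))

  -- for a non-matching S both sides vanish (the empty set is a matching)
  balance-non-matching : ∀ {S} → ¬ IsMatching S →
                         nat ∣ S ∣ * W S - sum (λ v → D v S) ≈ coeff oneP (monomial S)
  balance-non-matching {S} ¬S-match = begin
    nat ∣ S ∣ * W S - sum (λ v → D v S)
      ≈⟨ +-cong (trans (*-congˡ (W-non-matching ¬S-match)) (zeroʳ _))
                (trans (-‿cong (sum-zero (λ v → D-non-matching v ¬S-match))) -0#≈0#) ⟩
    0# + 0#                   ≈⟨ +-identityʳ 0# ⟩
    0#                        ≈⟨ coeff-one-nonempty S (¬S-match ∘ empty-is-matching) ⟨
    coeff oneP (monomial S)   ∎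
    where
    empty-is-matching : ∣ S ∣ ≡ 0 → IsMatching S
    empty-is-matching size =
      ≡.subst IsMatching (≡.sym (monomial-zeros S (monomial-empty S size))) empty-matching

  coeff-square-free : Infeasible → ∀ S → coeff oneP (monomial S) ≈ coeff RHS (monomial S)
  coeff-square-free infeasible S = sym (begin
    coeff RHS (monomial S)
      ≈⟨ coeff-RHS (monomial S) ⟩
    sum (λ e → maybe′ (extend (Z e)) 0# (monomial S ∸ᵥ unit e)) - sum (λ v → extend (D v) (monomial S))
      ≈⟨ +-cong (sum-edge-terms-monomial S) (-‿cong (sum-cong-≋ (λ v → reflexive (extend-monomial (D v) S)))) ⟩
    nat ∣ S ∣ * W S - sum (λ v → D v S)
      ≈⟨ balance (matching? S) ⟩
    coeff oneP (monomial S) ∎)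
    where
    balance : Dec (IsMatching S) → nat ∣ S ∣ * W S - sum (λ v → D v S) ≈ coeff oneP (monomial S)
    balance (yes S-match) = balance-matching infeasible S-match
    balance (no ¬S-match) = balance-non-matching ¬S-match

  coeff-non-square-free : ∀ {u} → decode u ≡ nothing → coeff oneP u ≈ coeff RHS u
  coeff-non-square-free {u} u≡ = sym (begin
    coeff RHS u
      ≈⟨ coeff-RHS u ⟩
    sum (λ e → maybe′ (extend (Z e)) 0# (u ∸ᵥ unit e)) - sum (λ i → extend (D i) u)
      ≈⟨ +-cong (sum-zero (edge-term-non-square-free {u} u≡))
                (-‿cong (sum-zero (λ i → reflexive (≡.cong (maybe′ (D i) 0#) u≡)))) ⟩
    0# - 0#          ≈⟨ -‿inverseʳ 0# ⟩
    0#               ≈⟨ coeff-constP-other 1# zeros≢u ⟨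
    coeff oneP u     ∎)
    where
    zeros≢u : zeros ≢ u
    zeros≢u eq with () ← ≡.trans (≡.sym u≡) (≡.trans (≡.cong decode (≡.sym eq)) decode-zeros)

  certificate : Infeasible → IsCertificate Δ Θ
  certificate infeasible u with decode u in u≡
  ... | just S rewrite decode-just u u≡ = coeff-square-free infeasible S
  ... | nothing = coeff-non-square-free u≡

  Δ-nonzero : Infeasible → ∀ M → IsMatching M → ∀ v → ¬ (coeff (Δ v) (monomial M) ≈ 0#)
  Δ-nonzero infeasible M M-match v =
    D-nonzero infeasible M-match v ∘ trans (sym (coeff-subsetPoly-monomial (D v) M))

  -- property (a): Δ_v involves exactly the matchings, so its degree is the maximum matching size
  Δ-degree : Infeasible → ∀ v k → MaxMatchingSize k → HasDegree (Δ v) k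
  Δ-degree infeasible v k ((M , M-match , size) , maximum) =
    at-most , monomial M , ≡.trans (degree-monomial M) size , Δ-nonzero infeasible M M-match v
    where
    at-most : DegreeAtMost (Δ v) k
    at-most u k<deg = trans (coeff-subsetPoly (D v) u) vanishes
      where
      vanishes : extend (D v) u ≈ 0#
      vanishes with decode u in u≡
      ... | nothing = refl
      ... | just S with matching? S
      ...   | no ¬S-match = D-non-matching v ¬S-match
      ...   | yes S-match =
        ⊥-elim (ℕP.<⇒≱ k<deg (≡.subst (ℕ._≤ k) (≡.sym (degree-decode u u≡)) (maximum S S-match)))

  -- property (c): a monomial x^N of Θ^i_{ef} has N ∪ {f} a matching, which occurs in
  -- every Δ_l with the larger degree |N| + 1
  Θ-degree : Infeasible → ∀ i e f → Valid i e f → ∀ l d → HasDegree (Δ l) d → DegreeAtMost (Θ i e f) d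
  Θ-degree infeasible i e f _ l d (Δ-at-most , _) u d<deg = trans (coeff-subsetPoly (T i e f) u) vanishes
    where
    vanishes : extend (T i e f) u ≈ 0#
    vanishes with decode u in u≡
    ... | nothing = refl
    ... | just N with lookup N f in f∈N
    ...   | true  = refl
    ...   | false with matching? (N [ f ]≔ true)
    ...     | no ¬N∪f-match = H-non-matching i e ¬N∪f-match
    ...     | yes N∪f-match = ⊥-elim (Δ-nonzero infeasible _ N∪f-match l (Δ-at-most _ d<deg′))
      where
      d<deg′ : d ℕ.< Vec.sum (monomial (N [ f ]≔ true))
      d<deg′ = ℕP.<-trans (≡.subst (d ℕ.<_) (degree-decode u u≡) d<deg)
                          (≡.subst (∣ N ∣ ℕ.<_) (≡.sym N∪f-degree) (ℕP.n<1+n ∣ N ∣))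
        where
        N∪f-degree : Vec.sum (monomial (N [ f ]≔ true)) ≡ suc ∣ N ∣
        N∪f-degree = ≡.trans (degree-monomial (N [ f ]≔ true)) (∣insert∣ N f f∈N)

proposition4p2 : ∀ {c ℓ} (F : Field c ℓ) → CharZero F →
    ∀ {n} (G : SimpleGraph n) →
    let open Matching F G in
    Infeasible →
    ∃₂ λ (Δ : Fin n → Pol) (Θ : Fin n → Fin m → Fin m → Pol) →
        IsCertificate Δ Θ
      × (∀ i k → MaxMatchingSize k → HasDegree (Δ i) k)
      × (∀ (M : Subset m) → IsMatching M → ∀ i → ¬ (Field._≈_ F (coeff (Δ i) (matchingMon M)) (Field.0# F)))
      × (∀ i e f → Valid i e f → ∀ l d → HasDegree (Δ l) d → DegreeAtMost (Θ i e f) d)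
proposition4p2 F char0 G infeasible =
  Δ , Θ , certificate infeasible , Δ-degree infeasible , Δ-nonzero infeasible , Θ-degree infeasible
  where open Construction F char0 G
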